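{- Let $(\mathcal C,\otimes,I,\gamma)$ be a symmetric monoidal category and $\mathcal T$ a strong monad on it. The following are equivalent: (1) for every object $X$ of $\mathcal C$, $\mathcal T$ admits a terminal central cone at $X$; (2) there exists a commutative submonad $\mathcal Z$ of $\mathcal T$ such that the canonical embedding functor $\mathcal I:\mathcal C_{\mathcal Z}\to\mathcal C_{\mathcal T}$ corestricts to an isomorphism of categories $\mathcal C_{\mathcal Z}\cong Z(\mathcal C_{\mathcal T})$; (3) the corestriction $\hat{\mathcal J}:\mathcal C\to Z(\mathcal C_{\mathcal T})$ of the Kleisli left adjoint $\mathcal J:\mathcal C\to\mathcal C_{\mathcal T}$ to the premonoidal centre is also a left adjoint.
   Context: $\mathcal T=(\mathcal T,\eta,\mu,\tau)$ with left strength $\tau_{X,Y}:X\otimes\mathcal TY\to\mathcal T(X\otimes Y)$ and right strength $\tau'_{X,Y}=\mathcal T(\gamma_{Y,X})\circ\tau_{Y,X}\circ\gamma_{\mathcal TX,Y}$. Commutative: $\mu\circ\mathcal T\tau'\circ\tau=\mu\circ\mathcal T\tau\circ\tau'$. A central cone of $\mathcal T$ at $X$ is $(W,\iota)$ with $\iota:W\to\mathcal TX$ such that for all $Y$, $\mu\circ\mathcal T\tau'_{X,Y}\circ\tau_{\mathcal TX,Y}\circ(\iota\otimes\mathcal TY)=\mu\circ\mathcal T\tau_{X,Y}\circ\tau'_{X,\mathcal TY}\circ(\iota\otimes\mathcal TY)$; morphisms of central cones $\varphi:(W',\iota')\to(W,\iota)$ satisfy $\iota\circ\varphi=\iota'$,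 and a terminal central cone is terminal in this category. A morphism of strong monads $\iota:\mathcal S\Rightarrow\mathcal T$ is a natural transformation compatible with units, multiplications and strengths ($\iota\circ\eta^{\mathcal S}=\eta^{\mathcal T}$, $\iota\circ\mu^{\mathcal S}=\mu^{\mathcal T}\circ\mathcal T\iota\circ\iota_{\mathcal S}$, $\iota\circ\tau^{\mathcal S}=\tau^{\mathcal T}\circ(X\otimes\iota)$); a commutative submonad is a commutative strong monad with such a $\iota$ that is a monomorphism in the category of strong monads. Kleisli category $\mathcal C_{\mathcal T}$: morphisms $X\to\mathcal TY$, composition $g\odot f=\mu\circ\mathcal Tg\circ f$; $\mathcal J$ is identity on objects and $f\mapsto\eta\circ f$. Canonical embedding $\mathcal I(f)=\iota_Y\circ f$. For $f:Y\to\mathcal TZ$, $f\otimes_l X=\tau'_{Z,X}\circ(f\otimes X)$, $X\otimes_r f=\tau_{X,Z}\circ(X\otimes f)$; $f:X\to\mathcal TY$ is central if $(f\otimes_l Y')\odot(X\otimes_r f')=(Y\otimes_r f')\odot(f\otimes_l X')$ for all $f':X'\to\mathcal TY'$. The premonoidal centre $Z(\mathcal C_{\mathcal T})$ is the subcategory with all objects and central morphisms; $\mathcal J$ always lands in it, giving the corestriction $\hat{\mathcal J}$. -}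

module Defs where

open import Level using (Level; _⊔_; suc)
open import Relation.Binary using (Rel; IsEquivalence; Setoid)
open import Relation.Binary.PropositionalEquality using (_≡_; refl; subst₂)
open import Data.Product using (Σ; _,_; proj₁; proj₂; _×_)
import Relation.Binary.Reasoning.Setoid as SetoidR

record Category (o ℓ e : Level) : Set (suc (o ⊔ ℓ ⊔ e)) where
  infix  4 _≈_ _⇒_
  infixr 9 _∘_
  field
    Obj : Set o
    _⇒_ : Obj → Obj → Set ℓ
    _≈_ : ∀ {A B} → Rel (A ⇒ B) e
    id  : ∀ {A} → A ⇒ A
    _∘_ : ∀ {A B C} → B ⇒ C → A ⇒ B → A ⇒ C
    equiv     : ∀ {A B} → IsEquivalence (_≈_ {A} {B})
    ∘-resp-≈  : ∀ {A B C} {f h : B ⇒ C} {g i : A ⇒ B} → f ≈ h → g ≈ i → f ∘ g ≈ h ∘ i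
    identityˡ : ∀ {A B} {f : A ⇒ B} → id ∘ f ≈ f
    identityʳ : ∀ {A B} {f : A ⇒ B} → f ∘ id ≈ f
    assoc     : ∀ {A B C D} {f : A ⇒ B} {g : B ⇒ C} {h : C ⇒ D} →
                (h ∘ g) ∘ f ≈ h ∘ (g ∘ f)

  hom-setoid : ∀ {A B} → Setoid ℓ e
  hom-setoid {A} {B} = record { Carrier = A ⇒ B ; _≈_ = _≈_ ; isEquivalence = equiv }

  ≈-refl : ∀ {A B} {f : A ⇒ B} → f ≈ f
  ≈-refl = IsEquivalence.refl equiv
  ≈-sym : ∀ {A B} {f g : A ⇒ B} → f ≈ g → g ≈ f
  ≈-sym = IsEquivalence.sym equiv
  ≈-trans : ∀ {A B} {f g h : A ⇒ B} → f ≈ g → g ≈ h → f ≈ h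
  ≈-trans = IsEquivalence.trans equiv

module HomReasoning {o ℓ e : Level} (C : Category o ℓ e) where
  open Category C
  open module R {A} {B} = SetoidR (hom-setoid {A} {B}) public

  infixr 4 _⟩∘⟨_ refl⟩∘⟨_
  infixl 5 _⟩∘⟨refl
  _⟩∘⟨_ : ∀ {A B C} {f h : B ⇒ C} {g i : A ⇒ B} → f ≈ h → g ≈ i → f ∘ g ≈ h ∘ i
  _⟩∘⟨_ = ∘-resp-≈
  refl⟩∘⟨_ : ∀ {A B C} {f : B ⇒ C} {g i : A ⇒ B} → g ≈ i → f ∘ g ≈ f ∘ i
  refl⟩∘⟨_ p = ∘-resp-≈ ≈-refl p
  _⟩∘⟨refl : ∀ {A B C} {f h : B ⇒ C} {g : A ⇒ B} → f ≈ h → f ∘ g ≈ h ∘ g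
  _⟩∘⟨refl p = ∘-resp-≈ p ≈-refl

  pullˡ : ∀ {A B B' C} {a : B ⇒ C} {b : B' ⇒ B} {c : B' ⇒ C} {d : A ⇒ B'} →
          a ∘ b ≈ c → a ∘ (b ∘ d) ≈ c ∘ d
  pullˡ p = ≈-trans (≈-sym assoc) (p ⟩∘⟨refl)

  pushˡ : ∀ {A B B' C} {a : B ⇒ C} {b : B' ⇒ B} {c : B' ⇒ C} {d : A ⇒ B'} →
          c ≈ a ∘ b → c ∘ d ≈ a ∘ (b ∘ d)
  pushˡ p = ≈-trans (p ⟩∘⟨refl) assoc

record Functor {o ℓ e o' ℓ' e' : Level}
               (C : Category o ℓ e) (D : Category o' ℓ' e') :
               Set (o ⊔ ℓ ⊔ e ⊔ o' ⊔ ℓ' ⊔ e') where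
  private
    module C = Category C
    module D = Category D
  field
    F₀ : C.Obj → D.Obj
    F₁ : ∀ {A B} → A C.⇒ B → F₀ A D.⇒ F₀ B
    identity     : ∀ {A} → F₁ (C.id {A}) D.≈ D.id
    homomorphism : ∀ {A B K} {f : A C.⇒ B} {g : B C.⇒ K} →
                   F₁ (g C.∘ f) D.≈ F₁ g D.∘ F₁ f
    F-resp-≈     : ∀ {A B} {f g : A C.⇒ B} → f C.≈ g → F₁ f D.≈ F₁ g

record Adjunction {o ℓ e o' ℓ' e' : Level}
                  {C : Category o ℓ e} {D : Category o' ℓ' e'}
                  (L : Functor C D) (R : Functor D C) :
                  Set (o ⊔ ℓ ⊔ e ⊔ o' ⊔ ℓ' ⊔ e') where
  private
    module C = Category C
    module D = Category D
    module L = Functor L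
    module R = Functor R
  field
    unit   : ∀ X → X C.⇒ R.F₀ (L.F₀ X)
    counit : ∀ Y → L.F₀ (R.F₀ Y) D.⇒ Y
    unit-natural   : ∀ {X X'} (f : X C.⇒ X') →
                     R.F₁ (L.F₁ f) C.∘ unit X C.≈ unit X' C.∘ f
    counit-natural : ∀ {Y Y'} (g : Y D.⇒ Y') →
                     counit Y' D.∘ L.F₁ (R.F₁ g) D.≈ g D.∘ counit Y
    zig : ∀ X → counit (L.F₀ X) D.∘ L.F₁ (unit X) D.≈ D.id
    zag : ∀ Y → R.F₁ (counit Y) C.∘ unit (R.F₀ Y) C.≈ C.id

IsLeftAdjoint : {o ℓ e o' ℓ' e' : Level}
                {C : Category o ℓ e} {D : Category o' ℓ' e'} →
                Functor C D → Set (o ⊔ ℓ ⊔ e ⊔ o' ⊔ ℓ' ⊔ e')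
IsLeftAdjoint {C = C} {D = D} L = Σ (Functor D C) (λ R → Adjunction L R)

-- F is an isomorphism of categories: it has a strict inverse functor G,
-- i.e. G ∘ F = Id and F ∘ G = Id (on objects up to ≡, on morphisms up
-- to the hom-setoid equality after transport along the object equalities).
record IsIsomorphism {o ℓ e o' ℓ' e' : Level}
                     {C : Category o ℓ e} {D : Category o' ℓ' e'}
                     (F : Functor C D) : Set (o ⊔ ℓ ⊔ e ⊔ o' ⊔ ℓ' ⊔ e') where
  private
    module C = Category C
    module D = Category D
    module F = Functor F
  field
    inverse : Functor D C
  private
    module G = Functor inverse
  field
    GF₀ : ∀ X → G.F₀ (F.F₀ X) ≡ X
    FG₀ : ∀ Y → F.F₀ (G.F₀ Y) ≡ Y
    GF₁ : ∀ {X X'} (f : X C.⇒ X') →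
          subst₂ C._⇒_ (GF₀ X) (GF₀ X') (G.F₁ (F.F₁ f)) C.≈ f
    FG₁ : ∀ {Y Y'} (g : Y D.⇒ Y') →
          subst₂ D._⇒_ (FG₀ Y) (FG₀ Y') (F.F₁ (G.F₁ g)) D.≈ g

record ClosedPred {o ℓ e : Level} (C : Category o ℓ e) (p : Level) :
                  Set (o ⊔ ℓ ⊔ suc p) where
  open Category C
  field
    P      : ∀ {A B} → A ⇒ B → Set p
    P-id   : ∀ {A} → P (id {A})
    P-∘    : ∀ {A B K} {g : B ⇒ K} {f : A ⇒ B} → P g → P f → P (g ∘ f)

Subcategory : {o ℓ e p : Level} (C : Category o ℓ e) → ClosedPred C p →
              Category o (ℓ ⊔ p) e
Subcategory C CP = record
  { Obj = Obj
  ; _⇒_ = λ A B → Σ (A ⇒ B) P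
  ; _≈_ = λ f g → proj₁ f ≈ proj₁ g
  ; id = id , P-id
  ; _∘_ = λ g f → (proj₁ g ∘ proj₁ f) , P-∘ (proj₂ g) (proj₂ f)
  ; equiv = record { refl = ≈-refl ; sym = ≈-sym ; trans = ≈-trans }
  ; ∘-resp-≈ = ∘-resp-≈
  ; identityˡ = identityˡ
  ; identityʳ = identityʳ
  ; assoc = assoc
  }
  where open Category C
        open ClosedPred CP

corestrict : {o ℓ e o' ℓ' e' p : Level}
             {C : Category o ℓ e} {D : Category o' ℓ' e'} →
             (F : Functor C D) (CP : ClosedPred D p) →
             (∀ {A B} (f : Category._⇒_ C A B) → ClosedPred.P CP (Functor.F₁ F f)) →
             Functor C (Subcategory D CP)
corestrict F CP lands = record
  { F₀ = F₀
  ; F₁ = λ f → F₁ f , lands f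
  ; identity = identity
  ; homomorphism = homomorphism
  ; F-resp-≈ = F-resp-≈
  }
  where open Functor F

record SymmetricMonoidal {o ℓ e : Level} (C : Category o ℓ e) :
                         Set (o ⊔ ℓ ⊔ e) where
  open Category C
  infixr 10 _⊗₀_ _⊗₁_
  field
    _⊗₀_ : Obj → Obj → Obj
    _⊗₁_ : ∀ {A B A' B'} → A ⇒ B → A' ⇒ B' → A ⊗₀ A' ⇒ B ⊗₀ B'
    ⊗-identity     : ∀ {A B} → id {A} ⊗₁ id {B} ≈ id
    ⊗-homomorphism : ∀ {A B K A' B' K'} {f : A ⇒ B} {g : B ⇒ K}
                       {f' : A' ⇒ B'} {g' : B' ⇒ K'} →
                     (g ∘ f) ⊗₁ (g' ∘ f') ≈ (g ⊗₁ g') ∘ (f ⊗₁ f')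
    ⊗-resp-≈ : ∀ {A B A' B'} {f g : A ⇒ B} {f' g' : A' ⇒ B'} →
               f ≈ g → f' ≈ g' → f ⊗₁ f' ≈ g ⊗₁ g'
    unit : Obj
    λ⇒ : ∀ {X} → unit ⊗₀ X ⇒ X
    λ⇐ : ∀ {X} → X ⇒ unit ⊗₀ X
    λ-isoˡ : ∀ {X} → λ⇐ {X} ∘ λ⇒ ≈ id
    λ-isoʳ : ∀ {X} → λ⇒ {X} ∘ λ⇐ ≈ id
    λ-natural : ∀ {X Y} {f : X ⇒ Y} → λ⇒ ∘ (id {unit} ⊗₁ f) ≈ f ∘ λ⇒
    ρ⇒ : ∀ {X} → X ⊗₀ unit ⇒ X
    ρ⇐ : ∀ {X} → X ⇒ X ⊗₀ unit
    ρ-isoˡ : ∀ {X} → ρ⇐ {X} ∘ ρ⇒ ≈ id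
    ρ-isoʳ : ∀ {X} → ρ⇒ {X} ∘ ρ⇐ ≈ id
    ρ-natural : ∀ {X Y} {f : X ⇒ Y} → ρ⇒ ∘ (f ⊗₁ id {unit}) ≈ f ∘ ρ⇒
    α⇒ : ∀ {X Y Z} → (X ⊗₀ Y) ⊗₀ Z ⇒ X ⊗₀ (Y ⊗₀ Z)
    α⇐ : ∀ {X Y Z} → X ⊗₀ (Y ⊗₀ Z) ⇒ (X ⊗₀ Y) ⊗₀ Z
    α-isoˡ : ∀ {X Y Z} → α⇐ ∘ α⇒ {X} {Y} {Z} ≈ id
    α-isoʳ : ∀ {X Y Z} → α⇒ ∘ α⇐ {X} {Y} {Z} ≈ id
    α-natural : ∀ {X X' Y Y' Z Z'} {f : X ⇒ X'} {g : Y ⇒ Y'} {h : Z ⇒ Z'} →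
                α⇒ ∘ ((f ⊗₁ g) ⊗₁ h) ≈ (f ⊗₁ (g ⊗₁ h)) ∘ α⇒
    triangle : ∀ {X Y} → (id {X} ⊗₁ λ⇒ {Y}) ∘ α⇒ ≈ ρ⇒ ⊗₁ id {Y}
    pentagon : ∀ {W X Y Z} →
               (id {W} ⊗₁ α⇒ {X} {Y} {Z}) ∘ α⇒ ∘ (α⇒ ⊗₁ id {Z}) ≈ α⇒ ∘ α⇒
    γ : ∀ {X Y} → X ⊗₀ Y ⇒ Y ⊗₀ X
    γ-natural : ∀ {X X' Y Y'} {f : X ⇒ X'} {g : Y ⇒ Y'} →
                γ ∘ (f ⊗₁ g) ≈ (g ⊗₁ f) ∘ γ
    γ-involutive : ∀ {X Y} → γ {Y} {X} ∘ γ {X} {Y} ≈ id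
    hexagon : ∀ {X Y Z} →
              α⇒ {Y} {Z} {X} ∘ γ {X} {Y ⊗₀ Z} ∘ α⇒ {X} {Y} {Z}
              ≈ (id {Y} ⊗₁ γ {X} {Z}) ∘ α⇒ {Y} {X} {Z} ∘ (γ {X} {Y} ⊗₁ id {Z})

record StrongMonad {o ℓ e : Level} {C : Category o ℓ e}
                   (M : SymmetricMonoidal C) : Set (o ⊔ ℓ ⊔ e) where
  open Category C
  open SymmetricMonoidal M
  field
    T₀ : Obj → Obj
    T₁ : ∀ {A B} → A ⇒ B → T₀ A ⇒ T₀ B
    T-identity     : ∀ {A} → T₁ (id {A}) ≈ id
    T-homomorphism : ∀ {A B K} {f : A ⇒ B} {g : B ⇒ K} → T₁ (g ∘ f) ≈ T₁ g ∘ T₁ f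
    T-resp-≈       : ∀ {A B} {f g : A ⇒ B} → f ≈ g → T₁ f ≈ T₁ g
    η : ∀ {X} → X ⇒ T₀ X
    μ : ∀ {X} → T₀ (T₀ X) ⇒ T₀ X
    η-natural : ∀ {X Y} {f : X ⇒ Y} → T₁ f ∘ η ≈ η ∘ f
    μ-natural : ∀ {X Y} {f : X ⇒ Y} → T₁ f ∘ μ ≈ μ ∘ T₁ (T₁ f)
    identityˡ-μ : ∀ {X} → μ ∘ T₁ (η {X}) ≈ id
    identityʳ-μ : ∀ {X} → μ ∘ η {T₀ X} ≈ id
    assoc-μ     : ∀ {X} → μ ∘ T₁ (μ {X}) ≈ μ ∘ μ
    τ : ∀ {X Y} → X ⊗₀ T₀ Y ⇒ T₀ (X ⊗₀ Y)
    τ-natural : ∀ {X X' Y Y'} {f : X ⇒ X'} {g : Y ⇒ Y'} →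
                τ ∘ (f ⊗₁ T₁ g) ≈ T₁ (f ⊗₁ g) ∘ τ
    τ-λ : ∀ {Y} → T₁ λ⇒ ∘ τ {unit} {Y} ≈ λ⇒
    τ-α : ∀ {X Y Z} →
          T₁ α⇒ ∘ τ {X ⊗₀ Y} {Z} ≈ τ {X} {Y ⊗₀ Z} ∘ (id {X} ⊗₁ τ {Y} {Z}) ∘ α⇒
    τ-η : ∀ {X Y} → τ ∘ (id {X} ⊗₁ η {Y}) ≈ η
    τ-μ : ∀ {X Y} → τ ∘ (id {X} ⊗₁ μ {Y}) ≈ μ ∘ T₁ τ ∘ τ

  τ' : ∀ {X Y} → T₀ X ⊗₀ Y ⇒ T₀ (X ⊗₀ Y)
  τ' {X} {Y} = T₁ (γ {Y} {X}) ∘ τ {Y} {X} ∘ γ {T₀ X} {Y}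

  infixr 9 _⊙_
  _⊙_ : ∀ {A B K} → B ⇒ T₀ K → A ⇒ T₀ B → A ⇒ T₀ K
  g ⊙ f = μ ∘ T₁ g ∘ f

  _⊗l_ : ∀ {Y Z} → Y ⇒ T₀ Z → (X : Obj) → Y ⊗₀ X ⇒ T₀ (Z ⊗₀ X)
  f ⊗l X = τ' ∘ (f ⊗₁ id {X})
  _⊗r_ : ∀ {Y Z} → (X : Obj) → Y ⇒ T₀ Z → X ⊗₀ Y ⇒ T₀ (X ⊗₀ Z)
  X ⊗r f = τ ∘ (id {X} ⊗₁ f)

  IsCentral : ∀ {X Y} → X ⇒ T₀ Y → Set (o ⊔ ℓ ⊔ e)
  IsCentral {X} {Y} f =
    ∀ {X' Y'} (f' : X' ⇒ T₀ Y') →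
    (f ⊗l Y') ⊙ (X ⊗r f') ≈ (Y ⊗r f') ⊙ (f ⊗l X')

  IsCommutative : Set (o ⊔ e)
  IsCommutative = ∀ {X Y} → μ ∘ T₁ (τ' {X} {Y}) ∘ τ {T₀ X} {Y}
                            ≈ μ ∘ T₁ (τ {X} {Y}) ∘ τ' {X} {T₀ Y}

module _ {o ℓ e : Level} {C : Category o ℓ e} {M : SymmetricMonoidal C}
         (T : StrongMonad M) where
  open Category C
  open SymmetricMonoidal M
  open StrongMonad T

  record CentralCone (X : Obj) : Set (o ⊔ ℓ ⊔ e) where
    field
      W : Obj
      ι : W ⇒ T₀ X
      central : ∀ Y →
        μ ∘ T₁ (τ' {X} {Y}) ∘ τ {T₀ X} {Y} ∘ (ι ⊗₁ id {T₀ Y})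
        ≈ μ ∘ T₁ (τ {X} {Y}) ∘ τ' {X} {T₀ Y} ∘ (ι ⊗₁ id {T₀ Y})

  ConeMorphism : ∀ {X} → CentralCone X → CentralCone X → Set (ℓ ⊔ e)
  ConeMorphism c' c = Σ (CentralCone.W c' ⇒ CentralCone.W c)
                        (λ φ → CentralCone.ι c ∘ φ ≈ CentralCone.ι c')

  IsTerminalCentralCone : ∀ {X} → CentralCone X → Set (o ⊔ ℓ ⊔ e)
  IsTerminalCentralCone c =
    ∀ c' → Σ (ConeMorphism c' c)
             (λ φ → ∀ (ψ : ConeMorphism c' c) → proj₁ ψ ≈ proj₁ φ)

  HasTerminalCentralCone : Obj → Set (o ⊔ ℓ ⊔ e)
  HasTerminalCentralCone X = Σ (CentralCone X) IsTerminalCentralCone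

record StrongMonadMorphism {o ℓ e : Level} {C : Category o ℓ e}
                           {M : SymmetricMonoidal C}
                           (S T : StrongMonad M) : Set (o ⊔ ℓ ⊔ e) where
  open Category C
  open SymmetricMonoidal M
  private
    module S = StrongMonad S
    module T = StrongMonad T
  field
    ι : ∀ {X} → S.T₀ X ⇒ T.T₀ X
    ι-natural : ∀ {X Y} {f : X ⇒ Y} → ι ∘ S.T₁ f ≈ T.T₁ f ∘ ι
    ι-η : ∀ {X} → ι ∘ S.η {X} ≈ T.η
    ι-μ : ∀ {X} → ι ∘ S.μ {X} ≈ T.μ ∘ T.T₁ ι ∘ ι {S.T₀ X}
    ι-τ : ∀ {X Y} → ι ∘ S.τ {X} {Y} ≈ T.τ ∘ (id {X} ⊗₁ ι {Y})

module _ {o ℓ e : Level} {C : Category o ℓ e} {M : SymmetricMonoidal C} where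
  open Category C

  IsMonoStrong : {S T : StrongMonad M} → StrongMonadMorphism S T → Set (o ⊔ ℓ ⊔ e)
  IsMonoStrong {S} {T} i =
    ∀ (R : StrongMonad M) (a b : StrongMonadMorphism R S) →
    (∀ {X} → StrongMonadMorphism.ι i ∘ StrongMonadMorphism.ι a {X}
             ≈ StrongMonadMorphism.ι i ∘ StrongMonadMorphism.ι b {X}) →
    ∀ {X} → StrongMonadMorphism.ι a {X} ≈ StrongMonadMorphism.ι b {X}

module KleisliConstructions {o ℓ e : Level} {C : Category o ℓ e}
                            {M : SymmetricMonoidal C} (T : StrongMonad M) where
  open Category C
  open SymmetricMonoidal M
  open StrongMonad T
  open HomReasoning C

  ⊙-resp-≈ : ∀ {A B K} {g g' : B ⇒ T₀ K} {f f' : A ⇒ T₀ B} →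
             g ≈ g' → f ≈ f' → g ⊙ f ≈ g' ⊙ f'
  ⊙-resp-≈ p q = refl⟩∘⟨ T-resp-≈ p ⟩∘⟨ q

  ⊙-identityˡ : ∀ {A B} {f : A ⇒ T₀ B} → η ⊙ f ≈ f
  ⊙-identityˡ {f = f} = begin
    μ ∘ T₁ η ∘ f ≈⟨ pullˡ identityˡ-μ ⟩
    id ∘ f       ≈⟨ identityˡ ⟩
    f            ∎

  ⊙-identityʳ : ∀ {A B} {f : A ⇒ T₀ B} → f ⊙ η ≈ f
  ⊙-identityʳ {f = f} = begin
    μ ∘ T₁ f ∘ η ≈⟨ refl⟩∘⟨ η-natural ⟩
    μ ∘ η ∘ f    ≈⟨ pullˡ identityʳ-μ ⟩
    id ∘ f       ≈⟨ identityˡ ⟩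
    f            ∎

  ⊙-assoc : ∀ {A B K D} {f : A ⇒ T₀ B} {g : B ⇒ T₀ K} {h : K ⇒ T₀ D} →
            (h ⊙ g) ⊙ f ≈ h ⊙ (g ⊙ f)
  ⊙-assoc {f = f} {g} {h} = begin
    μ ∘ T₁ (μ ∘ T₁ h ∘ g) ∘ f          ≈⟨ refl⟩∘⟨ T-homomorphism ⟩∘⟨refl ⟩
    μ ∘ (T₁ μ ∘ T₁ (T₁ h ∘ g)) ∘ f     ≈⟨ refl⟩∘⟨ assoc ⟩
    μ ∘ T₁ μ ∘ T₁ (T₁ h ∘ g) ∘ f       ≈⟨ pullˡ assoc-μ ⟩
    (μ ∘ μ) ∘ T₁ (T₁ h ∘ g) ∘ f        ≈⟨ assoc ⟩
    μ ∘ μ ∘ T₁ (T₁ h ∘ g) ∘ f          ≈⟨ refl⟩∘⟨ refl⟩∘⟨ T-homomorphism ⟩∘⟨refl ⟩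
    μ ∘ μ ∘ (T₁ (T₁ h) ∘ T₁ g) ∘ f     ≈⟨ refl⟩∘⟨ refl⟩∘⟨ assoc ⟩
    μ ∘ μ ∘ T₁ (T₁ h) ∘ T₁ g ∘ f       ≈⟨ refl⟩∘⟨ pullˡ (≈-sym μ-natural) ⟩
    μ ∘ (T₁ h ∘ μ) ∘ T₁ g ∘ f          ≈⟨ refl⟩∘⟨ assoc ⟩
    μ ∘ T₁ h ∘ μ ∘ T₁ g ∘ f            ∎

  Kleisli : Category o ℓ e
  Kleisli = record
    { Obj = Obj
    ; _⇒_ = λ A B → A ⇒ T₀ B
    ; _≈_ = _≈_
    ; id = η
    ; _∘_ = _⊙_
    ; equiv = equiv
    ; ∘-resp-≈ = ⊙-resp-≈
    ; identityˡ = ⊙-identityˡ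
    ; identityʳ = ⊙-identityʳ
    ; assoc = λ {A} {B} {K} {D} {f} {g} {h} → ⊙-assoc {f = f} {g} {h}
    }

  J : Functor C Kleisli
  J = record
    { F₀ = λ X → X
    ; F₁ = λ f → η ∘ f
    ; identity = identityʳ
    ; homomorphism = λ {A} {B} {K} {f} {g} → begin
        η ∘ g ∘ f                  ≈⟨ identityˡ ⟨
        id ∘ η ∘ g ∘ f             ≈⟨ identityʳ-μ ⟩∘⟨refl ⟨
        (μ ∘ η) ∘ η ∘ g ∘ f        ≈⟨ assoc ⟩
        μ ∘ η ∘ η ∘ g ∘ f          ≈⟨ refl⟩∘⟨ refl⟩∘⟨ assoc ⟨
        μ ∘ η ∘ (η ∘ g) ∘ f        ≈⟨ refl⟩∘⟨ assoc ⟨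
        μ ∘ (η ∘ (η ∘ g)) ∘ f      ≈⟨ refl⟩∘⟨ η-natural ⟩∘⟨refl ⟨
        μ ∘ (T₁ (η ∘ g) ∘ η) ∘ f   ≈⟨ refl⟩∘⟨ assoc ⟩
        μ ∘ T₁ (η ∘ g) ∘ η ∘ f     ∎
    ; F-resp-≈ = λ p → refl⟩∘⟨ p
    }

  τ'-η : ∀ {X Y} → τ' {X} {Y} ∘ (η ⊗₁ id) ≈ η
  τ'-η {X} {Y} = begin
    (T₁ γ ∘ τ ∘ γ) ∘ (η ⊗₁ id)     ≈⟨ assoc ⟩
    T₁ γ ∘ (τ ∘ γ) ∘ (η ⊗₁ id)     ≈⟨ refl⟩∘⟨ assoc ⟩
    T₁ γ ∘ τ ∘ γ ∘ (η ⊗₁ id)       ≈⟨ refl⟩∘⟨ refl⟩∘⟨ γ-natural ⟩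
    T₁ γ ∘ τ ∘ (id ⊗₁ η) ∘ γ       ≈⟨ refl⟩∘⟨ pullˡ τ-η ⟩
    T₁ γ ∘ η ∘ γ                   ≈⟨ pullˡ η-natural ⟩
    (η ∘ γ) ∘ γ                    ≈⟨ assoc ⟩
    η ∘ γ ∘ γ                      ≈⟨ refl⟩∘⟨ γ-involutive ⟩
    η ∘ id                         ≈⟨ identityʳ ⟩
    η                              ∎

  τ'-natural : ∀ {X X' Y Y'} {f : X ⇒ X'} {g : Y ⇒ Y'} →
               τ' ∘ (T₁ f ⊗₁ g) ≈ T₁ (f ⊗₁ g) ∘ τ'
  τ'-natural {f = f} {g} = begin
    (T₁ γ ∘ τ ∘ γ) ∘ (T₁ f ⊗₁ g)       ≈⟨ assoc ⟩
    T₁ γ ∘ (τ ∘ γ) ∘ (T₁ f ⊗₁ g)       ≈⟨ refl⟩∘⟨ assoc ⟩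
    T₁ γ ∘ τ ∘ γ ∘ (T₁ f ⊗₁ g)         ≈⟨ refl⟩∘⟨ refl⟩∘⟨ γ-natural ⟩
    T₁ γ ∘ τ ∘ (g ⊗₁ T₁ f) ∘ γ         ≈⟨ refl⟩∘⟨ pullˡ τ-natural ⟩
    T₁ γ ∘ (T₁ (g ⊗₁ f) ∘ τ) ∘ γ       ≈⟨ refl⟩∘⟨ assoc ⟩
    T₁ γ ∘ T₁ (g ⊗₁ f) ∘ τ ∘ γ         ≈⟨ pullˡ (≈-sym T-homomorphism) ⟩
    T₁ (γ ∘ (g ⊗₁ f)) ∘ τ ∘ γ          ≈⟨ T-resp-≈ γ-natural ⟩∘⟨refl ⟩
    T₁ ((f ⊗₁ g) ∘ γ) ∘ τ ∘ γ          ≈⟨ T-homomorphism ⟩∘⟨refl ⟩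
    (T₁ (f ⊗₁ g) ∘ T₁ γ) ∘ τ ∘ γ       ≈⟨ assoc ⟩
    T₁ (f ⊗₁ g) ∘ T₁ γ ∘ τ ∘ γ         ∎

  τ'-μ : ∀ {X Y} → τ' {X} {Y} ∘ (μ ⊗₁ id) ≈ μ ∘ T₁ τ' ∘ τ'
  τ'-μ {X} {Y} = begin
    (T₁ γ ∘ τ ∘ γ) ∘ (μ ⊗₁ id)            ≈⟨ assoc ⟩
    T₁ γ ∘ (τ ∘ γ) ∘ (μ ⊗₁ id)            ≈⟨ refl⟩∘⟨ assoc ⟩
    T₁ γ ∘ τ ∘ γ ∘ (μ ⊗₁ id)              ≈⟨ refl⟩∘⟨ refl⟩∘⟨ γ-natural ⟩
    T₁ γ ∘ τ ∘ (id ⊗₁ μ) ∘ γ              ≈⟨ refl⟩∘⟨ pullˡ τ-μ ⟩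
    T₁ γ ∘ (μ ∘ T₁ τ ∘ τ) ∘ γ             ≈⟨ refl⟩∘⟨ assoc ⟩
    T₁ γ ∘ μ ∘ (T₁ τ ∘ τ) ∘ γ             ≈⟨ pullˡ μ-natural ⟩
    (μ ∘ T₁ (T₁ γ)) ∘ (T₁ τ ∘ τ) ∘ γ      ≈⟨ assoc ⟩
    μ ∘ T₁ (T₁ γ) ∘ (T₁ τ ∘ τ) ∘ γ        ≈⟨ refl⟩∘⟨ refl⟩∘⟨ assoc ⟩
    μ ∘ T₁ (T₁ γ) ∘ T₁ τ ∘ τ ∘ γ          ≈⟨ refl⟩∘⟨ refl⟩∘⟨ refl⟩∘⟨ step ⟩
    μ ∘ T₁ (T₁ γ) ∘ T₁ τ ∘ T₁ γ ∘ T₁ γ ∘ τ ∘ γ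
         ≈⟨ refl⟩∘⟨ gather ⟩
    μ ∘ T₁ (T₁ γ ∘ τ ∘ γ) ∘ T₁ γ ∘ τ ∘ γ  ∎
    where
    step : τ ∘ γ ≈ T₁ γ ∘ T₁ γ ∘ τ ∘ γ
    step = begin
      τ ∘ γ                    ≈⟨ identityˡ ⟨
      id ∘ τ ∘ γ               ≈⟨ T-identity ⟩∘⟨refl ⟨
      T₁ id ∘ τ ∘ γ            ≈⟨ T-resp-≈ γ-involutive ⟩∘⟨refl ⟨
      T₁ (γ ∘ γ) ∘ τ ∘ γ       ≈⟨ T-homomorphism ⟩∘⟨refl ⟩
      (T₁ γ ∘ T₁ γ) ∘ τ ∘ γ    ≈⟨ assoc ⟩
      T₁ γ ∘ T₁ γ ∘ τ ∘ γ      ∎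
    gather : T₁ (T₁ γ) ∘ T₁ τ ∘ T₁ γ ∘ T₁ γ ∘ τ ∘ γ
             ≈ T₁ (T₁ γ ∘ τ ∘ γ) ∘ T₁ γ ∘ τ ∘ γ
    gather = begin
      T₁ (T₁ γ) ∘ T₁ τ ∘ T₁ γ ∘ T₁ γ ∘ τ ∘ γ    ≈⟨ refl⟩∘⟨ pullˡ (≈-sym T-homomorphism) ⟩
      T₁ (T₁ γ) ∘ T₁ (τ ∘ γ) ∘ T₁ γ ∘ τ ∘ γ     ≈⟨ pullˡ (≈-sym T-homomorphism) ⟩
      T₁ (T₁ γ ∘ τ ∘ γ) ∘ T₁ γ ∘ τ ∘ γ          ∎

  ⊗l-⊙ : ∀ {A B K W} {f : A ⇒ T₀ B} {g : B ⇒ T₀ K} →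
         (g ⊙ f) ⊗l W ≈ (g ⊗l W) ⊙ (f ⊗l W)
  ⊗l-⊙ {W = W} {f} {g} = begin
    τ' ∘ ((μ ∘ T₁ g ∘ f) ⊗₁ id)                 ≈⟨ refl⟩∘⟨ ⊗-resp-≈ ≈-refl (≈-sym identityˡ) ⟩
    τ' ∘ ((μ ∘ T₁ g ∘ f) ⊗₁ (id ∘ id))          ≈⟨ refl⟩∘⟨ ⊗-homomorphism ⟩
    τ' ∘ (μ ⊗₁ id) ∘ ((T₁ g ∘ f) ⊗₁ id)         ≈⟨ pullˡ τ'-μ ⟩
    (μ ∘ T₁ τ' ∘ τ') ∘ ((T₁ g ∘ f) ⊗₁ id)       ≈⟨ refl⟩∘⟨ ⊗-resp-≈ ≈-refl (≈-sym identityˡ) ⟩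
    (μ ∘ T₁ τ' ∘ τ') ∘ ((T₁ g ∘ f) ⊗₁ (id ∘ id)) ≈⟨ refl⟩∘⟨ ⊗-homomorphism ⟩
    (μ ∘ T₁ τ' ∘ τ') ∘ (T₁ g ⊗₁ id) ∘ (f ⊗₁ id) ≈⟨ assoc ⟩
    μ ∘ (T₁ τ' ∘ τ') ∘ (T₁ g ⊗₁ id) ∘ (f ⊗₁ id) ≈⟨ refl⟩∘⟨ assoc ⟩
    μ ∘ T₁ τ' ∘ τ' ∘ (T₁ g ⊗₁ id) ∘ (f ⊗₁ id)   ≈⟨ refl⟩∘⟨ refl⟩∘⟨ pullˡ τ'-natural ⟩
    μ ∘ T₁ τ' ∘ (T₁ (g ⊗₁ id) ∘ τ') ∘ (f ⊗₁ id) ≈⟨ refl⟩∘⟨ refl⟩∘⟨ assoc ⟩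
    μ ∘ T₁ τ' ∘ T₁ (g ⊗₁ id) ∘ τ' ∘ (f ⊗₁ id)   ≈⟨ refl⟩∘⟨ pullˡ (≈-sym T-homomorphism) ⟩
    μ ∘ T₁ (τ' ∘ (g ⊗₁ id)) ∘ τ' ∘ (f ⊗₁ id)    ∎

  ⊗l-η : ∀ {A W} → η {A} ⊗l W ≈ η
  ⊗l-η = τ'-η

  ⊗r-η : ∀ {A W} → W ⊗r η {A} ≈ η
  ⊗r-η = τ-η

  η-central : ∀ {A} → IsCentral (η {A})
  η-central {A} {X'} {Y'} f' = begin
    (η ⊗l Y') ⊙ (A ⊗r f')   ≈⟨ ⊙-resp-≈ ⊗l-η ≈-refl ⟩
    η ⊙ (A ⊗r f')           ≈⟨ ⊙-identityˡ ⟩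
    A ⊗r f'                 ≈⟨ ⊙-identityʳ ⟨
    (A ⊗r f') ⊙ η           ≈⟨ ⊙-resp-≈ ≈-refl ⊗l-η ⟨
    (A ⊗r f') ⊙ (η ⊗l X')   ∎

  ⊙-central : ∀ {A B K} {g : B ⇒ T₀ K} {f : A ⇒ T₀ B} →
              IsCentral g → IsCentral f → IsCentral (g ⊙ f)
  ⊙-central {A} {B} {K} {g} {f} cg cf {X'} {Y'} f' = begin
    ((g ⊙ f) ⊗l Y') ⊙ (A ⊗r f')                 ≈⟨ ⊙-resp-≈ ⊗l-⊙ ≈-refl ⟩
    ((g ⊗l Y') ⊙ (f ⊗l Y')) ⊙ (A ⊗r f')         ≈⟨ ⊙-assoc ⟩
    (g ⊗l Y') ⊙ ((f ⊗l Y') ⊙ (A ⊗r f'))         ≈⟨ ⊙-resp-≈ ≈-refl (cf f') ⟩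
    (g ⊗l Y') ⊙ ((B ⊗r f') ⊙ (f ⊗l X'))         ≈⟨ ⊙-assoc ⟨
    ((g ⊗l Y') ⊙ (B ⊗r f')) ⊙ (f ⊗l X')         ≈⟨ ⊙-resp-≈ (cg f') ≈-refl ⟩
    ((K ⊗r f') ⊙ (g ⊗l X')) ⊙ (f ⊗l X')         ≈⟨ ⊙-assoc ⟩
    (K ⊗r f') ⊙ ((g ⊗l X') ⊙ (f ⊗l X'))         ≈⟨ ⊙-resp-≈ ≈-refl ⊗l-⊙ ⟨
    (K ⊗r f') ⊙ ((g ⊙ f) ⊗l X')                 ∎

  CentralPred : ClosedPred Kleisli (o ⊔ ℓ ⊔ e)
  CentralPred = record
    { P = IsCentral
    ; P-id = η-central
    ; P-∘ = ⊙-central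
    }

  Centre : Category o (o ⊔ ℓ ⊔ e) e
  Centre = Subcategory Kleisli CentralPred

  pure-⊙ : ∀ {A B K} {h : B ⇒ K} {k : A ⇒ T₀ B} → (η ∘ h) ⊙ k ≈ T₁ h ∘ k
  pure-⊙ {h = h} {k} = begin
    μ ∘ T₁ (η ∘ h) ∘ k       ≈⟨ refl⟩∘⟨ T-homomorphism ⟩∘⟨refl ⟩
    μ ∘ (T₁ η ∘ T₁ h) ∘ k    ≈⟨ refl⟩∘⟨ assoc ⟩
    μ ∘ T₁ η ∘ T₁ h ∘ k      ≈⟨ pullˡ identityˡ-μ ⟩
    id ∘ T₁ h ∘ k            ≈⟨ identityˡ ⟩
    T₁ h ∘ k                 ∎

  ⊙-pure : ∀ {A B K} {h : A ⇒ B} {k : B ⇒ T₀ K} → k ⊙ (η ∘ h) ≈ k ∘ h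
  ⊙-pure {h = h} {k} = begin
    μ ∘ T₁ k ∘ η ∘ h         ≈⟨ refl⟩∘⟨ pullˡ η-natural ⟩
    μ ∘ (η ∘ k) ∘ h          ≈⟨ refl⟩∘⟨ assoc ⟩
    μ ∘ η ∘ k ∘ h            ≈⟨ pullˡ identityʳ-μ ⟩
    id ∘ k ∘ h               ≈⟨ identityˡ ⟩
    k ∘ h                    ∎

  ⊗l-pure : ∀ {A B W} {f : A ⇒ B} → (η ∘ f) ⊗l W ≈ η ∘ (f ⊗₁ id)
  ⊗l-pure {f = f} = begin
    τ' ∘ ((η ∘ f) ⊗₁ id)           ≈⟨ refl⟩∘⟨ ⊗-resp-≈ ≈-refl (≈-sym identityˡ) ⟩
    τ' ∘ ((η ∘ f) ⊗₁ (id ∘ id))    ≈⟨ refl⟩∘⟨ ⊗-homomorphism ⟩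
    τ' ∘ (η ⊗₁ id) ∘ (f ⊗₁ id)     ≈⟨ pullˡ τ'-η ⟩
    η ∘ (f ⊗₁ id)                  ∎

  J-central : ∀ {A B} (f : A ⇒ B) → IsCentral (η ∘ f)
  J-central {A} {B} f {X'} {Y'} f' = begin
    ((η ∘ f) ⊗l Y') ⊙ (A ⊗r f')               ≈⟨ ⊙-resp-≈ ⊗l-pure ≈-refl ⟩
    (η ∘ (f ⊗₁ id)) ⊙ (τ ∘ (id ⊗₁ f'))        ≈⟨ pure-⊙ ⟩
    T₁ (f ⊗₁ id) ∘ τ ∘ (id ⊗₁ f')             ≈⟨ pullˡ (≈-sym τ-natural) ⟩
    (τ ∘ (f ⊗₁ T₁ id)) ∘ (id ⊗₁ f')           ≈⟨ assoc ⟩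
    τ ∘ (f ⊗₁ T₁ id) ∘ (id ⊗₁ f')             ≈⟨ refl⟩∘⟨ ⊗-homomorphism ⟨
    τ ∘ ((f ∘ id) ⊗₁ (T₁ id ∘ f'))            ≈⟨ refl⟩∘⟨ ⊗-resp-≈ middle₁ middle₂ ⟩
    τ ∘ ((id ∘ f) ⊗₁ (f' ∘ id))               ≈⟨ refl⟩∘⟨ ⊗-homomorphism ⟩
    τ ∘ (id ⊗₁ f') ∘ (f ⊗₁ id)                ≈⟨ assoc ⟨
    (τ ∘ (id ⊗₁ f')) ∘ (f ⊗₁ id)              ≈⟨ ⊙-pure ⟨
    (B ⊗r f') ⊙ (η ∘ (f ⊗₁ id))               ≈⟨ ⊙-resp-≈ ≈-refl ⊗l-pure ⟨
    (B ⊗r f') ⊙ ((η ∘ f) ⊗l X')               ∎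
    where
    middle₁ : f ∘ id ≈ id ∘ f
    middle₁ = ≈-trans identityʳ (≈-sym identityˡ)
    middle₂ : T₁ id ∘ f' ≈ f' ∘ id
    middle₂ = ≈-trans (T-identity ⟩∘⟨refl) (≈-trans identityˡ (≈-sym identityʳ))

  Ĵ : Functor C Centre
  Ĵ = corestrict J CentralPred J-central

module _ {o ℓ e : Level} {C : Category o ℓ e} {M : SymmetricMonoidal C}
         {S T : StrongMonad M} (i : StrongMonadMorphism S T) where
  open Category C
  open HomReasoning C
  private
    module S = StrongMonad S
    module T = StrongMonad T
    module KS = KleisliConstructions S
    module KT = KleisliConstructions T
  open StrongMonadMorphism i

  CanonicalEmbedding : Functor KS.Kleisli KT.Kleisli
  CanonicalEmbedding = record
    { F₀ = λ X → X
    ; F₁ = λ f → ι ∘ f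
    ; identity = ι-η
    ; homomorphism = λ {A} {B} {K} {f} {g} → begin
        ι ∘ S.μ ∘ S.T₁ g ∘ f               ≈⟨ pullˡ ι-μ ⟩
        (T.μ ∘ T.T₁ ι ∘ ι) ∘ S.T₁ g ∘ f    ≈⟨ assoc ⟩
        T.μ ∘ (T.T₁ ι ∘ ι) ∘ S.T₁ g ∘ f    ≈⟨ refl⟩∘⟨ assoc ⟩
        T.μ ∘ T.T₁ ι ∘ ι ∘ S.T₁ g ∘ f      ≈⟨ refl⟩∘⟨ refl⟩∘⟨ pullˡ ι-natural ⟩
        T.μ ∘ T.T₁ ι ∘ (T.T₁ g ∘ ι) ∘ f    ≈⟨ refl⟩∘⟨ refl⟩∘⟨ assoc ⟩
        T.μ ∘ T.T₁ ι ∘ T.T₁ g ∘ ι ∘ f      ≈⟨ refl⟩∘⟨ pullˡ (≈-sym T.T-homomorphism) ⟩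
        T.μ ∘ T.T₁ (ι ∘ g) ∘ ι ∘ f         ∎
    ; F-resp-≈ = λ p → refl⟩∘⟨ p
    }

module _ {o ℓ e : Level} {C : Category o ℓ e} {M : SymmetricMonoidal C} where
  open Category C

  Condition1 : StrongMonad M → Set (o ⊔ ℓ ⊔ e)
  Condition1 T = ∀ (X : Obj) → HasTerminalCentralCone T X

  Condition2 : StrongMonad M → Set (o ⊔ ℓ ⊔ e)
  Condition2 T =
    Σ (StrongMonad M) λ Z →
    StrongMonad.IsCommutative Z ×
    Σ (StrongMonadMorphism Z T) λ i →
    IsMonoStrong i ×
    Σ (∀ {A B} (f : A ⇒ StrongMonad.T₀ Z B) →
         StrongMonad.IsCentral T (StrongMonadMorphism.ι i ∘ f)) λ lands →
    IsIsomorphism (corestrict (CanonicalEmbedding i)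
                              (KleisliConstructions.CentralPred T) lands)

  Condition3 : StrongMonad M → Set (o ⊔ ℓ ⊔ e)
  Condition3 T = IsLeftAdjoint (KleisliConstructions.Ĵ T)

-- A central cone (W, ι) at X is the same thing as a central Kleisli map ι : W → T X, i.e. a
-- morphism Ĵ W → X of the premonoidal centre Z(C_T), and a map φ : W' → W is a morphism of
-- cones exactly when ι ⊙ Ĵ φ ≈ ι ∘ φ equals ι'. So a terminal central cone at X is precisely a
-- universal arrow from Ĵ : C → Z(C_T) to X, and (1) ⇔ (3) is the description of left adjoints
-- by universal arrows.
--
-- For (1) ⇒ (2), let Z X be the apex of the terminal central cone at X. The maps T f ∘ ι, η,
-- ι ⊙ ι and A ⊗r ι are central (for the last, the hexagon axiom makes the strength and the
-- costrength commute up to α), so each factors uniquely through ι, and ι is monic. Transporting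
-- the laws of T along ι makes Z a strong submonad of T, commutative because ι is central, and
-- factoring central maps through ι inverts the canonical embedding C_Z → Z(C_T). Conversely,
-- the inverse of that isomorphism factors every central cone through ι, which gives (2) ⇒ (1).

module Submission where

open import Level using (_⊔_)
open import Relation.Binary using (IsEquivalence)
open import Relation.Binary.PropositionalEquality using (_≡_; refl; subst₂)
open import Data.Product using (Σ; _,_; proj₁; proj₂; _×_)
open import Function.Bundles using (_⇔_; mk⇔)
open import Defs

record UniversalArrow {o ℓ e o' ℓ' e'} {C : Category o ℓ e} {D : Category o' ℓ' e'}
                      (L : Functor C D) (Y : Category.Obj D) :
                      Set (o ⊔ ℓ ⊔ e ⊔ ℓ' ⊔ e') where
  private
    module C = Category C
    module D = Category D
    module L = Functor L
  field
    obj             : C.Obj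
    counit          : L.F₀ obj D.⇒ Y
    factor          : ∀ {A} → L.F₀ A D.⇒ Y → A C.⇒ obj
    factor-commutes : ∀ {A} (g : L.F₀ A D.⇒ Y) → counit D.∘ L.F₁ (factor g) D.≈ g
    factor-unique   : ∀ {A} {g : L.F₀ A D.⇒ Y} {h : A C.⇒ obj} →
                      counit D.∘ L.F₁ h D.≈ g → h C.≈ factor g

  factor-cancel : ∀ {A} {h h' : A C.⇒ obj} →
                  counit D.∘ L.F₁ h D.≈ counit D.∘ L.F₁ h' → h C.≈ h'
  factor-cancel p = C.≈-trans (factor-unique p) (C.≈-sym (factor-unique D.≈-refl))

module _ {o ℓ e o' ℓ' e'} {C : Category o ℓ e} {D : Category o' ℓ' e'}
         (L : Functor C D) where
  private
    module C = Category C
    module D = Category D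
    module L = Functor L

  module _ (u : ∀ Y → UniversalArrow L Y) where
    private
      module U Y = UniversalArrow (u Y)
      open D using (_⇒_; _∘_; _≈_; ≈-trans)
      open HomReasoning D

      ε : ∀ Y → L.F₀ (U.obj Y) ⇒ Y
      ε = U.counit

      ε-∘ : ∀ {Y A B} {h : B C.⇒ U.obj Y} {k : A C.⇒ B} →
            ε Y ∘ L.F₁ (h C.∘ k) ≈ (ε Y ∘ L.F₁ h) ∘ L.F₁ k
      ε-∘ = ≈-trans (refl⟩∘⟨ L.homomorphism) (D.≈-sym D.assoc)

      R₁ : ∀ {Y Y'} → Y ⇒ Y' → U.obj Y C.⇒ U.obj Y'
      R₁ {Y} {Y'} g = U.factor Y' (g ∘ ε Y)

      ε-R₁ : ∀ {Y Y'} (g : Y ⇒ Y') → ε Y' ∘ L.F₁ (R₁ g) ≈ g ∘ ε Y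
      ε-R₁ {Y} {Y'} g = U.factor-commutes Y' (g ∘ ε Y)

      η : ∀ X → X C.⇒ U.obj (L.F₀ X)
      η X = U.factor (L.F₀ X) D.id

      ε-η : ∀ X → ε (L.F₀ X) ∘ L.F₁ (η X) ≈ D.id
      ε-η X = U.factor-commutes (L.F₀ X) D.id

    rightAdjoint : Functor D C
    rightAdjoint = record
      { F₀ = U.obj
      ; F₁ = R₁
      ; identity = C.≈-sym (U.factor-unique _ (begin
          ε _ ∘ L.F₁ C.id  ≈⟨ refl⟩∘⟨ L.identity ⟩
          ε _ ∘ D.id       ≈⟨ D.identityʳ ⟩
          ε _              ≈⟨ D.identityˡ ⟨
          D.id ∘ ε _       ∎))
      ; homomorphism = λ {_} {_} {_} {f} {g} → C.≈-sym (U.factor-unique _ (begin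
          ε _ ∘ L.F₁ (R₁ g C.∘ R₁ f)         ≈⟨ ε-∘ ⟩
          (ε _ ∘ L.F₁ (R₁ g)) ∘ L.F₁ (R₁ f)  ≈⟨ ε-R₁ g ⟩∘⟨refl ⟩
          (g ∘ ε _) ∘ L.F₁ (R₁ f)            ≈⟨ D.assoc ⟩
          g ∘ ε _ ∘ L.F₁ (R₁ f)              ≈⟨ refl⟩∘⟨ ε-R₁ f ⟩
          g ∘ f ∘ ε _                        ≈⟨ D.assoc ⟨
          (g ∘ f) ∘ ε _                      ∎))
      ; F-resp-≈ = λ {_} {_} {f} p → U.factor-unique _ (≈-trans (ε-R₁ f) (p ⟩∘⟨refl))
      }

    rightAdjoint-adjunction : Adjunction L rightAdjoint
    rightAdjoint-adjunction = record
      { unit = η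
      ; counit = ε
      ; unit-natural = λ f → U.factor-cancel _ (begin
          ε _ ∘ L.F₁ (R₁ (L.F₁ f) C.∘ η _)         ≈⟨ ε-∘ ⟩
          (ε _ ∘ L.F₁ (R₁ (L.F₁ f))) ∘ L.F₁ (η _)  ≈⟨ ε-R₁ (L.F₁ f) ⟩∘⟨refl ⟩
          (L.F₁ f ∘ ε _) ∘ L.F₁ (η _)              ≈⟨ D.assoc ⟩
          L.F₁ f ∘ ε _ ∘ L.F₁ (η _)                ≈⟨ refl⟩∘⟨ ε-η _ ⟩
          L.F₁ f ∘ D.id                            ≈⟨ D.identityʳ ⟩
          L.F₁ f                                   ≈⟨ D.identityˡ ⟨
          D.id ∘ L.F₁ f                            ≈⟨ ε-η _ ⟩∘⟨refl ⟨
          (ε _ ∘ L.F₁ (η _)) ∘ L.F₁ f              ≈⟨ ε-∘ ⟨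
          ε _ ∘ L.F₁ (η _ C.∘ f)                   ∎)
      ; counit-natural = ε-R₁
      ; zig = ε-η
      ; zag = λ Y → U.factor-cancel Y (begin
          ε Y ∘ L.F₁ (R₁ (ε Y) C.∘ η _)         ≈⟨ ε-∘ ⟩
          (ε Y ∘ L.F₁ (R₁ (ε Y))) ∘ L.F₁ (η _)  ≈⟨ ε-R₁ (ε Y) ⟩∘⟨refl ⟩
          (ε Y ∘ ε _) ∘ L.F₁ (η _)              ≈⟨ D.assoc ⟩
          ε Y ∘ ε _ ∘ L.F₁ (η _)                ≈⟨ refl⟩∘⟨ ε-η _ ⟩
          ε Y ∘ D.id                            ≈⟨ refl⟩∘⟨ L.identity ⟨
          ε Y ∘ L.F₁ C.id                       ∎)
      }

  universalArrows⇒isLeftAdjoint : (∀ Y → UniversalArrow L Y) → IsLeftAdjoint L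
  universalArrows⇒isLeftAdjoint u = rightAdjoint u , rightAdjoint-adjunction u

  isLeftAdjoint⇒universalArrow : IsLeftAdjoint L → ∀ Y → UniversalArrow L Y
  isLeftAdjoint⇒universalArrow (R , adj) Y = record
    { obj = R.F₀ Y
    ; counit = A.counit Y
    ; factor = factor
    ; factor-commutes = factor-commutes
    ; factor-unique = factor-unique
    }
    where
    module R = Functor R
    module A = Adjunction adj

    factor : ∀ {A} → L.F₀ A D.⇒ Y → A C.⇒ R.F₀ Y
    factor g = R.F₁ g C.∘ A.unit _

    factor-commutes : ∀ {A} (g : L.F₀ A D.⇒ Y) → A.counit Y D.∘ L.F₁ (factor g) D.≈ g
    factor-commutes g = begin
      A.counit Y D.∘ L.F₁ (R.F₁ g C.∘ A.unit _)          ≈⟨ refl⟩∘⟨ L.homomorphism ⟩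
      A.counit Y D.∘ L.F₁ (R.F₁ g) D.∘ L.F₁ (A.unit _)   ≈⟨ pullˡ (A.counit-natural g) ⟩
      (g D.∘ A.counit _) D.∘ L.F₁ (A.unit _)             ≈⟨ D.assoc ⟩
      g D.∘ A.counit _ D.∘ L.F₁ (A.unit _)               ≈⟨ refl⟩∘⟨ A.zig _ ⟩
      g D.∘ D.id                                         ≈⟨ D.identityʳ ⟩
      g                                                  ∎
      where open HomReasoning D

    factor-unique : ∀ {A} {g : L.F₀ A D.⇒ Y} {h : A C.⇒ R.F₀ Y} →
                    A.counit Y D.∘ L.F₁ h D.≈ g → h C.≈ factor g
    factor-unique {g = g} {h} p = begin
      h                                                ≈⟨ C.identityˡ ⟨
      C.id C.∘ h                                       ≈⟨ A.zag Y ⟩∘⟨refl ⟨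
      (R.F₁ (A.counit Y) C.∘ A.unit _) C.∘ h           ≈⟨ C.assoc ⟩
      R.F₁ (A.counit Y) C.∘ A.unit _ C.∘ h             ≈⟨ refl⟩∘⟨ A.unit-natural h ⟨
      R.F₁ (A.counit Y) C.∘ R.F₁ (L.F₁ h) C.∘ A.unit _ ≈⟨ pullˡ (C.≈-sym R.homomorphism) ⟩
      R.F₁ (A.counit Y D.∘ L.F₁ h) C.∘ A.unit _        ≈⟨ R.F-resp-≈ p ⟩∘⟨refl ⟩
      R.F₁ g C.∘ A.unit _                              ∎
      where open HomReasoning C

module MonoidalLemmas {o ℓ e} {C : Category o ℓ e} (M : SymmetricMonoidal C) where
  open Category C
  open SymmetricMonoidal M
  open HomReasoning C

  assoc²' : ∀ {A B K D E} {a : D ⇒ E} {b : K ⇒ D} {c : B ⇒ K} {d : A ⇒ B} →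
            (a ∘ b ∘ c) ∘ d ≈ a ∘ b ∘ c ∘ d
  assoc²' = ≈-trans assoc (refl⟩∘⟨ assoc)

  cancelˡ : ∀ {A B K} {a : B ⇒ A} {b : A ⇒ B} {c : K ⇒ A} → a ∘ b ≈ id → a ∘ b ∘ c ≈ c
  cancelˡ ab = ≈-trans (pullˡ ab) identityˡ

  inverse-unique : ∀ {A B} {x : A ⇒ B} {l r : B ⇒ A} → x ∘ l ≈ id → r ∘ x ≈ id → l ≈ r
  inverse-unique {x = x} {l} {r} xl rx = begin
    l            ≈⟨ identityˡ ⟨
    id ∘ l       ≈⟨ rx ⟩∘⟨refl ⟨
    (r ∘ x) ∘ l  ≈⟨ assoc ⟩
    r ∘ x ∘ l    ≈⟨ refl⟩∘⟨ xl ⟩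
    r ∘ id       ≈⟨ identityʳ ⟩
    r            ∎

  serialize₁₂ : ∀ {A B A' B'} {f : A ⇒ B} {g : A' ⇒ B'} → f ⊗₁ g ≈ (f ⊗₁ id) ∘ (id ⊗₁ g)
  serialize₁₂ = ≈-trans (⊗-resp-≈ (≈-sym identityʳ) (≈-sym identityˡ)) ⊗-homomorphism

  serialize₂₁ : ∀ {A B A' B'} {f : A ⇒ B} {g : A' ⇒ B'} → f ⊗₁ g ≈ (id ⊗₁ g) ∘ (f ⊗₁ id)
  serialize₂₁ = ≈-trans (⊗-resp-≈ (≈-sym identityˡ) (≈-sym identityʳ)) ⊗-homomorphism

  split₁ : ∀ {P A B K} {a : B ⇒ K} {b : A ⇒ B} → (a ∘ b) ⊗₁ id {P} ≈ (a ⊗₁ id) ∘ (b ⊗₁ id)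
  split₁ = ≈-trans (⊗-resp-≈ ≈-refl (≈-sym identityˡ)) ⊗-homomorphism

  split₂ : ∀ {P A B K} {a : B ⇒ K} {b : A ⇒ B} → id {P} ⊗₁ (a ∘ b) ≈ (id ⊗₁ a) ∘ (id ⊗₁ b)
  split₂ = ≈-trans (⊗-resp-≈ (≈-sym identityˡ) ≈-refl) ⊗-homomorphism

  ⊗-inverse : ∀ {A B A' B'} {a : B ⇒ A} {b : A ⇒ B} {c : B' ⇒ A'} {d : A' ⇒ B'} →
              a ∘ b ≈ id → c ∘ d ≈ id → (a ⊗₁ c) ∘ (b ⊗₁ d) ≈ id
  ⊗-inverse ab cd = ≈-trans (≈-sym ⊗-homomorphism) (≈-trans (⊗-resp-≈ ab cd) ⊗-identity)

  hexagon-γα : ∀ {X Y Z} → γ {X} {Y ⊗₀ Z} ∘ α⇒ ≈ α⇐ ∘ (id ⊗₁ γ) ∘ α⇒ ∘ (γ ⊗₁ id)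
  hexagon-γα = ≈-trans (≈-sym (cancelˡ α-isoˡ)) (refl⟩∘⟨ hexagon)

  hexagon-αγ : ∀ {X Y Z} → α⇐ ∘ γ {Y ⊗₀ Z} {X} ≈ (γ ⊗₁ id) ∘ α⇐ ∘ (id ⊗₁ γ) ∘ α⇒
  hexagon-αγ = inverse-unique {x = γ ∘ α⇒} γα-αγ (begin
    ((γ ⊗₁ id) ∘ α⇐ ∘ (id ⊗₁ γ) ∘ α⇒) ∘ γ ∘ α⇒
      ≈⟨ refl⟩∘⟨ hexagon-γα ⟩
    ((γ ⊗₁ id) ∘ α⇐ ∘ (id ⊗₁ γ) ∘ α⇒) ∘ α⇐ ∘ (id ⊗₁ γ) ∘ α⇒ ∘ (γ ⊗₁ id)
      ≈⟨ ≈-trans assoc (refl⟩∘⟨ assoc²') ⟩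
    (γ ⊗₁ id) ∘ α⇐ ∘ (id ⊗₁ γ) ∘ α⇒ ∘ α⇐ ∘ (id ⊗₁ γ) ∘ α⇒ ∘ (γ ⊗₁ id)
      ≈⟨ refl⟩∘⟨ refl⟩∘⟨ refl⟩∘⟨ cancelˡ α-isoʳ ⟩
    (γ ⊗₁ id) ∘ α⇐ ∘ (id ⊗₁ γ) ∘ (id ⊗₁ γ) ∘ α⇒ ∘ (γ ⊗₁ id)
      ≈⟨ refl⟩∘⟨ refl⟩∘⟨ cancelˡ (⊗-inverse identityˡ γ-involutive) ⟩
    (γ ⊗₁ id) ∘ α⇐ ∘ α⇒ ∘ (γ ⊗₁ id)
      ≈⟨ refl⟩∘⟨ cancelˡ α-isoˡ ⟩
    (γ ⊗₁ id) ∘ (γ ⊗₁ id)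
      ≈⟨ ⊗-inverse γ-involutive identityˡ ⟩
    id ∎)
    where
    γα-αγ : (γ ∘ α⇒) ∘ α⇐ ∘ γ ≈ id
    γα-αγ = ≈-trans assoc (≈-trans (refl⟩∘⟨ cancelˡ α-isoʳ) γ-involutive)

module Centrality {o ℓ e} {C : Category o ℓ e} {M : SymmetricMonoidal C}
                  (T : StrongMonad M) where
  open Category C
  open SymmetricMonoidal M
  open StrongMonad T
  open KleisliConstructions T
  open HomReasoning C
  open MonoidalLemmas M

  τ-naturalˡ : ∀ {A A' X} {f : A ⇒ A'} → τ {A'} {X} ∘ (f ⊗₁ id) ≈ T₁ (f ⊗₁ id) ∘ τ
  τ-naturalˡ = ≈-trans (refl⟩∘⟨ ⊗-resp-≈ ≈-refl (≈-sym T-identity)) τ-natural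

  τ'-naturalʳ : ∀ {X B B'} {g : B ⇒ B'} → τ' {X} ∘ (id ⊗₁ g) ≈ T₁ (id ⊗₁ g) ∘ τ'
  τ'-naturalʳ = ≈-trans (refl⟩∘⟨ ⊗-resp-≈ (≈-sym T-identity) ≈-refl) τ'-natural

  -- T is commutative iff ψ ≈ ψ', and a central cone (W, ι) asks ψ ∘ (ι ⊗₁ id) ≈ ψ' ∘ (ι ⊗₁ id).
  ψ ψ' : ∀ {X Y} → T₀ X ⊗₀ T₀ Y ⇒ T₀ (X ⊗₀ Y)
  ψ  = μ ∘ T₁ τ' ∘ τ
  ψ' = μ ∘ T₁ τ ∘ τ'

  ⊗l-⊙-⊗r : ∀ {A B X Y} {f : A ⇒ T₀ X} {f' : B ⇒ T₀ Y} →
            (f ⊗l Y) ⊙ (A ⊗r f') ≈ ψ ∘ (f ⊗₁ f')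
  ⊗l-⊙-⊗r {f = f} {f'} = begin
    μ ∘ T₁ (τ' ∘ (f ⊗₁ id)) ∘ τ ∘ (id ⊗₁ f')     ≈⟨ refl⟩∘⟨ pushˡ T-homomorphism ⟩
    μ ∘ T₁ τ' ∘ T₁ (f ⊗₁ id) ∘ τ ∘ (id ⊗₁ f')    ≈⟨ refl⟩∘⟨ refl⟩∘⟨ pullˡ (≈-sym τ-naturalˡ) ⟩
    μ ∘ T₁ τ' ∘ (τ ∘ (f ⊗₁ id)) ∘ (id ⊗₁ f')     ≈⟨ refl⟩∘⟨ refl⟩∘⟨ pushˡ ≈-refl ⟩
    μ ∘ T₁ τ' ∘ τ ∘ (f ⊗₁ id) ∘ (id ⊗₁ f')       ≈⟨ refl⟩∘⟨ refl⟩∘⟨ refl⟩∘⟨ serialize₁₂ ⟨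
    μ ∘ T₁ τ' ∘ τ ∘ (f ⊗₁ f')                    ≈⟨ assoc²' ⟨
    ψ ∘ (f ⊗₁ f')                                ∎

  ⊗r-⊙-⊗l : ∀ {A B X Y} {f : A ⇒ T₀ X} {f' : B ⇒ T₀ Y} →
            (X ⊗r f') ⊙ (f ⊗l B) ≈ ψ' ∘ (f ⊗₁ f')
  ⊗r-⊙-⊗l {f = f} {f'} = begin
    μ ∘ T₁ (τ ∘ (id ⊗₁ f')) ∘ τ' ∘ (f ⊗₁ id)     ≈⟨ refl⟩∘⟨ pushˡ T-homomorphism ⟩
    μ ∘ T₁ τ ∘ T₁ (id ⊗₁ f') ∘ τ' ∘ (f ⊗₁ id)    ≈⟨ refl⟩∘⟨ refl⟩∘⟨ pullˡ (≈-sym τ'-naturalʳ) ⟩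
    μ ∘ T₁ τ ∘ (τ' ∘ (id ⊗₁ f')) ∘ (f ⊗₁ id)     ≈⟨ refl⟩∘⟨ refl⟩∘⟨ pushˡ ≈-refl ⟩
    μ ∘ T₁ τ ∘ τ' ∘ (id ⊗₁ f') ∘ (f ⊗₁ id)       ≈⟨ refl⟩∘⟨ refl⟩∘⟨ refl⟩∘⟨ serialize₂₁ ⟨
    μ ∘ T₁ τ ∘ τ' ∘ (f ⊗₁ f')                    ≈⟨ assoc²' ⟨
    ψ' ∘ (f ⊗₁ f')                               ∎

  centralCone : ∀ {A X} (f : A ⇒ T₀ X) → IsCentral f → CentralCone T X
  centralCone {A} {X} f cf = record { W = A ; ι = f ; central = central }
    where
    central : ∀ Y → μ ∘ T₁ τ' ∘ τ ∘ (f ⊗₁ id {T₀ Y}) ≈ μ ∘ T₁ τ ∘ τ' ∘ (f ⊗₁ id)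
    central Y = begin
      μ ∘ T₁ τ' ∘ τ ∘ (f ⊗₁ id)     ≈⟨ assoc²' ⟨
      ψ ∘ (f ⊗₁ id)                 ≈⟨ ⊗l-⊙-⊗r ⟨
      (f ⊗l Y) ⊙ (A ⊗r id)          ≈⟨ cf id ⟩
      (X ⊗r id) ⊙ (f ⊗l T₀ Y)       ≈⟨ ⊗r-⊙-⊗l ⟩
      ψ' ∘ (f ⊗₁ id)                ≈⟨ assoc²' ⟩
      μ ∘ T₁ τ ∘ τ' ∘ (f ⊗₁ id)     ∎

  cone-isCentral : ∀ {X} (c : CentralCone T X) → IsCentral (CentralCone.ι c)
  cone-isCentral {X} c {X'} {Y'} f' = begin
    (ι ⊗l Y') ⊙ (W ⊗r f')            ≈⟨ ⊗l-⊙-⊗r ⟩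
    ψ ∘ (ι ⊗₁ f')                    ≈⟨ refl⟩∘⟨ serialize₁₂ ⟩
    ψ ∘ (ι ⊗₁ id) ∘ (id ⊗₁ f')       ≈⟨ pullˡ cone-equation ⟩
    (ψ' ∘ (ι ⊗₁ id)) ∘ (id ⊗₁ f')    ≈⟨ pushˡ ≈-refl ⟩
    ψ' ∘ (ι ⊗₁ id) ∘ (id ⊗₁ f')      ≈⟨ refl⟩∘⟨ serialize₁₂ ⟨
    ψ' ∘ (ι ⊗₁ f')                   ≈⟨ ⊗r-⊙-⊗l ⟨
    (X ⊗r f') ⊙ (ι ⊗l X')            ∎
    where
    open CentralCone c
    cone-equation : ψ ∘ (ι ⊗₁ id) ≈ ψ' ∘ (ι ⊗₁ id)
    cone-equation = ≈-trans assoc²' (≈-trans (central Y') (≈-sym assoc²'))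

  central-resp-≈ : ∀ {A X} {f g : A ⇒ T₀ X} → f ≈ g → IsCentral f → IsCentral g
  central-resp-≈ {A} {X} {f} {g} f≈g cf {X'} {Y'} f' = begin
    (g ⊗l Y') ⊙ (A ⊗r f')    ≈⟨ ⊙-resp-≈ (refl⟩∘⟨ ⊗-resp-≈ f≈g ≈-refl) ≈-refl ⟨
    (f ⊗l Y') ⊙ (A ⊗r f')    ≈⟨ cf f' ⟩
    (X ⊗r f') ⊙ (f ⊗l X')    ≈⟨ ⊙-resp-≈ ≈-refl (refl⟩∘⟨ ⊗-resp-≈ f≈g ≈-refl) ⟩
    (X ⊗r f') ⊙ (g ⊗l X')    ∎

  central-∘ʳ : ∀ {A B X} {f : B ⇒ T₀ X} (h : A ⇒ B) → IsCentral f → IsCentral (f ∘ h)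
  central-∘ʳ h cf = central-resp-≈ ⊙-pure (⊙-central cf (J-central h))

  T₁-∘-central : ∀ {A X Y} {f : A ⇒ T₀ X} (h : X ⇒ Y) → IsCentral f → IsCentral (T₁ h ∘ f)
  T₁-∘-central h cf = central-resp-≈ pure-⊙ (⊙-central (J-central h) cf)

  ⊗r-resp-≈ : ∀ {P A B} {g h : A ⇒ T₀ B} → g ≈ h → P ⊗r g ≈ P ⊗r h
  ⊗r-resp-≈ g≈h = refl⟩∘⟨ ⊗-resp-≈ ≈-refl g≈h

  ⊗r-∘ : ∀ {P A B X} {b : B ⇒ T₀ X} {k : A ⇒ B} → (P ⊗r b) ∘ (id ⊗₁ k) ≈ P ⊗r (b ∘ k)
  ⊗r-∘ = ≈-trans assoc (refl⟩∘⟨ ≈-sym split₂)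

  ⊗r-⊙ : ∀ {P A B K} {g : B ⇒ T₀ K} {h : A ⇒ T₀ B} →
         P ⊗r (g ⊙ h) ≈ (P ⊗r g) ⊙ (P ⊗r h)
  ⊗r-⊙ {g = g} {h} = begin
    τ ∘ (id ⊗₁ (μ ∘ T₁ g ∘ h))                   ≈⟨ refl⟩∘⟨ ≈-trans split₂ (refl⟩∘⟨ split₂) ⟩
    τ ∘ (id ⊗₁ μ) ∘ (id ⊗₁ T₁ g) ∘ (id ⊗₁ h)     ≈⟨ pullˡ τ-μ ⟩
    (μ ∘ T₁ τ ∘ τ) ∘ (id ⊗₁ T₁ g) ∘ (id ⊗₁ h)    ≈⟨ assoc²' ⟩
    μ ∘ T₁ τ ∘ τ ∘ (id ⊗₁ T₁ g) ∘ (id ⊗₁ h)      ≈⟨ refl⟩∘⟨ refl⟩∘⟨ pullˡ τ-natural ⟩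
    μ ∘ T₁ τ ∘ (T₁ (id ⊗₁ g) ∘ τ) ∘ (id ⊗₁ h)    ≈⟨ refl⟩∘⟨ refl⟩∘⟨ assoc ⟩
    μ ∘ T₁ τ ∘ T₁ (id ⊗₁ g) ∘ τ ∘ (id ⊗₁ h)      ≈⟨ refl⟩∘⟨ pullˡ (≈-sym T-homomorphism) ⟩
    μ ∘ T₁ (τ ∘ (id ⊗₁ g)) ∘ τ ∘ (id ⊗₁ h)       ∎

  sandwich-∘ : ∀ {A B B' K K' D'} {p : K' ⇒ D'} {p₂ : K ⇒ K'} {k : B' ⇒ T₀ K}
                 {q₂ : B ⇒ B'} {q : A ⇒ B} →
               T₁ p ∘ (T₁ p₂ ∘ k ∘ q₂) ∘ q ≈ T₁ (p ∘ p₂) ∘ k ∘ (q₂ ∘ q)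
  sandwich-∘ = ≈-trans (refl⟩∘⟨ assoc²') (pullˡ (≈-sym T-homomorphism))

  ⊙-conjugate : ∀ {A A' B B' K K'} {p : K ⇒ K'} {g : B' ⇒ T₀ K} {q : B ⇒ B'}
                  {r : B' ⇒ B} {h : A' ⇒ T₀ B'} {s : A ⇒ A'} → q ∘ r ≈ id →
                (T₁ p ∘ g ∘ q) ⊙ (T₁ r ∘ h ∘ s) ≈ T₁ p ∘ (g ⊙ h) ∘ s
  ⊙-conjugate {p = p} {g} {q} {r} {h} {s} qr = begin
    μ ∘ T₁ (T₁ p ∘ g ∘ q) ∘ T₁ r ∘ h ∘ s     ≈⟨ refl⟩∘⟨ pullˡ (≈-sym T-homomorphism) ⟩
    μ ∘ T₁ ((T₁ p ∘ g ∘ q) ∘ r) ∘ h ∘ s      ≈⟨ refl⟩∘⟨ T-resp-≈ (≈-trans assoc²' (refl⟩∘⟨ refl⟩∘⟨ qr)) ⟩∘⟨refl ⟩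
    μ ∘ T₁ (T₁ p ∘ g ∘ id) ∘ h ∘ s           ≈⟨ refl⟩∘⟨ T-resp-≈ (refl⟩∘⟨ identityʳ) ⟩∘⟨refl ⟩
    μ ∘ T₁ (T₁ p ∘ g) ∘ h ∘ s                ≈⟨ refl⟩∘⟨ pushˡ T-homomorphism ⟩
    μ ∘ T₁ (T₁ p) ∘ T₁ g ∘ h ∘ s             ≈⟨ pullˡ (≈-sym μ-natural) ⟩
    (T₁ p ∘ μ) ∘ T₁ g ∘ h ∘ s                ≈⟨ assoc ⟩
    T₁ p ∘ μ ∘ T₁ g ∘ h ∘ s                  ≈⟨ refl⟩∘⟨ assoc²' ⟨
    T₁ p ∘ (μ ∘ T₁ g ∘ h) ∘ s                ∎

  ⊗r-sandwich : ∀ {P B B' K K'} {p : K ⇒ K'} {g : B' ⇒ T₀ K} {q : B ⇒ B'} →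
                P ⊗r (T₁ p ∘ g ∘ q) ≈ T₁ (id ⊗₁ p) ∘ (P ⊗r g) ∘ (id ⊗₁ q)
  ⊗r-sandwich {p = p} {g} {q} = begin
    τ ∘ (id ⊗₁ (T₁ p ∘ g ∘ q))                 ≈⟨ refl⟩∘⟨ ≈-trans split₂ (refl⟩∘⟨ split₂) ⟩
    τ ∘ (id ⊗₁ T₁ p) ∘ (id ⊗₁ g) ∘ (id ⊗₁ q)   ≈⟨ pullˡ τ-natural ⟩
    (T₁ (id ⊗₁ p) ∘ τ) ∘ (id ⊗₁ g) ∘ (id ⊗₁ q) ≈⟨ assoc ⟩
    T₁ (id ⊗₁ p) ∘ τ ∘ (id ⊗₁ g) ∘ (id ⊗₁ q)   ≈⟨ refl⟩∘⟨ assoc ⟨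
    T₁ (id ⊗₁ p) ∘ (τ ∘ (id ⊗₁ g)) ∘ (id ⊗₁ q) ∎

  τ-conjugate : ∀ {P P' X} {a : P' ⇒ P} {a' : P ⇒ P'} → a ∘ a' ≈ id →
                τ {P} {X} ≈ T₁ (a ⊗₁ id) ∘ τ ∘ (a' ⊗₁ id)
  τ-conjugate {a = a} {a'} aa' = ≈-sym (begin
    T₁ (a ⊗₁ id) ∘ τ ∘ (a' ⊗₁ id)   ≈⟨ pullˡ (≈-sym τ-naturalˡ) ⟩
    (τ ∘ (a ⊗₁ id)) ∘ (a' ⊗₁ id)    ≈⟨ pushˡ ≈-refl ⟩
    τ ∘ (a ⊗₁ id) ∘ (a' ⊗₁ id)      ≈⟨ refl⟩∘⟨ ⊗-inverse aa' identityˡ ⟩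
    τ ∘ id                          ≈⟨ identityʳ ⟩
    τ                               ∎)

  ⊗r-τ : ∀ {P Q X} → P ⊗r τ {Q} {X} ≈ T₁ α⇒ ∘ τ ∘ α⇐
  ⊗r-τ = begin
    τ ∘ (id ⊗₁ τ)               ≈⟨ identityʳ ⟨
    (τ ∘ (id ⊗₁ τ)) ∘ id        ≈⟨ refl⟩∘⟨ α-isoʳ ⟨
    (τ ∘ (id ⊗₁ τ)) ∘ α⇒ ∘ α⇐   ≈⟨ pullˡ (≈-trans assoc (≈-sym τ-α)) ⟩
    (T₁ α⇒ ∘ τ) ∘ α⇐            ≈⟨ assoc ⟩
    T₁ α⇒ ∘ τ ∘ α⇐              ∎

  τ-⊗₀ : ∀ {P Q X} → τ {P ⊗₀ Q} {X} ≈ T₁ α⇐ ∘ (P ⊗r τ) ∘ α⇒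
  τ-⊗₀ = ≈-sym (begin
    T₁ α⇐ ∘ (τ ∘ (id ⊗₁ τ)) ∘ α⇒    ≈⟨ refl⟩∘⟨ ≈-trans assoc (≈-sym τ-α) ⟩
    T₁ α⇐ ∘ T₁ α⇒ ∘ τ               ≈⟨ pullˡ (≈-sym T-homomorphism) ⟩
    T₁ (α⇐ ∘ α⇒) ∘ τ                ≈⟨ T-resp-≈ α-isoˡ ⟩∘⟨refl ⟩
    T₁ id ∘ τ                       ≈⟨ T-identity ⟩∘⟨refl ⟩
    id ∘ τ                          ≈⟨ identityˡ ⟩
    τ                               ∎)

  τ-⊗l : ∀ {P X Y} → τ {P} {X} ⊗l Y ≈ T₁ α⇐ ∘ (P ⊗r τ' {X} {Y}) ∘ α⇒
  τ-⊗l {P} {X} {Y} = begin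
    (T₁ γ ∘ τ ∘ γ) ∘ (τ ⊗₁ id)              ≈⟨ assoc²' ⟩
    T₁ γ ∘ τ ∘ γ ∘ (τ ⊗₁ id)                ≈⟨ refl⟩∘⟨ refl⟩∘⟨ γ-natural ⟩
    T₁ γ ∘ τ ∘ (id ⊗₁ τ) ∘ γ                ≈⟨ refl⟩∘⟨ assoc ⟨
    T₁ γ ∘ (Y ⊗r τ) ∘ γ                     ≈⟨ refl⟩∘⟨ ⊗r-τ ⟩∘⟨refl ⟩
    T₁ γ ∘ (T₁ α⇒ ∘ τ ∘ α⇐) ∘ γ             ≈⟨ sandwich-∘ ⟩
    T₁ (γ ∘ α⇒) ∘ τ ∘ (α⇐ ∘ γ)              ≈⟨ T-resp-≈ hexagon-γα ⟩∘⟨ refl⟩∘⟨ hexagon-αγ' ⟩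
    T₁ (α⇐ ∘ (id ⊗₁ γ) ∘ α⇒ ∘ (γ ⊗₁ id)) ∘ τ ∘ ((((γ ⊗₁ id) ∘ α⇐) ∘ (id ⊗₁ γ)) ∘ α⇒)
                                            ≈⟨ sandwich-∘ ⟨
    T₁ α⇐ ∘ (T₁ ((id ⊗₁ γ) ∘ α⇒ ∘ (γ ⊗₁ id)) ∘ τ ∘ (((γ ⊗₁ id) ∘ α⇐) ∘ (id ⊗₁ γ))) ∘ α⇒
                                            ≈⟨ refl⟩∘⟨ P⊗rτ' ⟩∘⟨refl ⟨
    T₁ α⇐ ∘ (P ⊗r τ') ∘ α⇒                  ∎
    where
    hexagon-αγ' : α⇐ ∘ γ ≈ (((γ ⊗₁ id) ∘ α⇐) ∘ (id ⊗₁ γ)) ∘ α⇒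
    hexagon-αγ' = ≈-trans hexagon-αγ (≈-sym (≈-trans assoc assoc))

    P⊗rτ' : P ⊗r τ' ≈ T₁ ((id ⊗₁ γ) ∘ α⇒ ∘ (γ ⊗₁ id)) ∘ τ ∘ (((γ ⊗₁ id) ∘ α⇐) ∘ (id ⊗₁ γ))
    P⊗rτ' = begin
      P ⊗r (T₁ γ ∘ τ ∘ γ)                                            ≈⟨ ⊗r-sandwich ⟩
      T₁ (id ⊗₁ γ) ∘ (P ⊗r τ) ∘ (id ⊗₁ γ)                            ≈⟨ refl⟩∘⟨ ⊗r-τ ⟩∘⟨refl ⟩
      T₁ (id ⊗₁ γ) ∘ (T₁ α⇒ ∘ τ ∘ α⇐) ∘ (id ⊗₁ γ)
        ≈⟨ refl⟩∘⟨ (refl⟩∘⟨ τ-conjugate γ-involutive ⟩∘⟨refl) ⟩∘⟨refl ⟩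
      T₁ (id ⊗₁ γ) ∘ (T₁ α⇒ ∘ (T₁ (γ ⊗₁ id) ∘ τ ∘ (γ ⊗₁ id)) ∘ α⇐) ∘ (id ⊗₁ γ)
        ≈⟨ refl⟩∘⟨ sandwich-∘ ⟩∘⟨refl ⟩
      T₁ (id ⊗₁ γ) ∘ (T₁ (α⇒ ∘ (γ ⊗₁ id)) ∘ τ ∘ ((γ ⊗₁ id) ∘ α⇐)) ∘ (id ⊗₁ γ)
        ≈⟨ sandwich-∘ ⟩
      T₁ ((id ⊗₁ γ) ∘ α⇒ ∘ (γ ⊗₁ id)) ∘ τ ∘ (((γ ⊗₁ id) ∘ α⇐) ∘ (id ⊗₁ γ)) ∎

  α-conjugate-⊗ : ∀ {P B B' Z Z' X Y} {b : B' ⊗₀ Z' ⇒ T₀ (X ⊗₀ Y)} {c : B ⇒ B'} {d : Z ⇒ Z'} →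
                  (T₁ α⇐ ∘ (P ⊗r b) ∘ α⇒) ∘ ((id ⊗₁ c) ⊗₁ d)
                  ≈ T₁ α⇐ ∘ (P ⊗r (b ∘ (c ⊗₁ d))) ∘ α⇒
  α-conjugate-⊗ {P} {b = b} {c} {d} = begin
    (T₁ α⇐ ∘ (P ⊗r b) ∘ α⇒) ∘ ((id ⊗₁ c) ⊗₁ d)   ≈⟨ assoc²' ⟩
    T₁ α⇐ ∘ (P ⊗r b) ∘ α⇒ ∘ ((id ⊗₁ c) ⊗₁ d)     ≈⟨ refl⟩∘⟨ refl⟩∘⟨ α-natural ⟩
    T₁ α⇐ ∘ (P ⊗r b) ∘ (id ⊗₁ (c ⊗₁ d)) ∘ α⇒     ≈⟨ refl⟩∘⟨ pullˡ ⊗r-∘ ⟩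
    T₁ α⇐ ∘ (P ⊗r (b ∘ (c ⊗₁ d))) ∘ α⇒           ∎

  ⊗r-⊗₀ : ∀ {P Q B X} {f : B ⇒ T₀ X} → (P ⊗₀ Q) ⊗r f ≈ T₁ α⇐ ∘ (P ⊗r (Q ⊗r f)) ∘ α⇒
  ⊗r-⊗₀ {P} {Q} {f = f} = begin
    τ ∘ (id ⊗₁ f)                                ≈⟨ refl⟩∘⟨ ⊗-resp-≈ ⊗-identity ≈-refl ⟨
    τ ∘ ((id ⊗₁ id) ⊗₁ f)                        ≈⟨ τ-⊗₀ ⟩∘⟨refl ⟩
    (T₁ α⇐ ∘ (P ⊗r τ) ∘ α⇒) ∘ ((id ⊗₁ id) ⊗₁ f)  ≈⟨ α-conjugate-⊗ ⟩
    T₁ α⇐ ∘ (P ⊗r (Q ⊗r f)) ∘ α⇒                 ∎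

  ⊗r-⊗l : ∀ {P B X Y} {f : B ⇒ T₀ X} → (P ⊗r f) ⊗l Y ≈ T₁ α⇐ ∘ (P ⊗r (f ⊗l Y)) ∘ α⇒
  ⊗r-⊗l {P} {Y = Y} {f} = begin
    τ' ∘ ((τ ∘ (id ⊗₁ f)) ⊗₁ id)                  ≈⟨ refl⟩∘⟨ split₁ ⟩
    τ' ∘ (τ ⊗₁ id) ∘ ((id ⊗₁ f) ⊗₁ id)            ≈⟨ assoc ⟨
    (τ ⊗l Y) ∘ ((id ⊗₁ f) ⊗₁ id)                  ≈⟨ τ-⊗l ⟩∘⟨refl ⟩
    (T₁ α⇐ ∘ (P ⊗r τ') ∘ α⇒) ∘ ((id ⊗₁ f) ⊗₁ id)  ≈⟨ α-conjugate-⊗ ⟩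
    T₁ α⇐ ∘ (P ⊗r (f ⊗l Y)) ∘ α⇒                  ∎

  ⊗r-central : ∀ {P B X} {f : B ⇒ T₀ X} → IsCentral f → IsCentral (P ⊗r f)
  ⊗r-central {P} {B} {X} {f} cf {X'} {Y'} f' = begin
    ((P ⊗r f) ⊗l Y') ⊙ ((P ⊗₀ B) ⊗r f')
      ≈⟨ ⊙-resp-≈ ⊗r-⊗l ⊗r-⊗₀ ⟩
    (T₁ α⇐ ∘ (P ⊗r (f ⊗l Y')) ∘ α⇒) ⊙ (T₁ α⇐ ∘ (P ⊗r (B ⊗r f')) ∘ α⇒)
      ≈⟨ ⊙-conjugate α-isoʳ ⟩
    T₁ α⇐ ∘ ((P ⊗r (f ⊗l Y')) ⊙ (P ⊗r (B ⊗r f'))) ∘ α⇒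
      ≈⟨ refl⟩∘⟨ ⊗r-⊙ ⟩∘⟨refl ⟨
    T₁ α⇐ ∘ (P ⊗r ((f ⊗l Y') ⊙ (B ⊗r f'))) ∘ α⇒
      ≈⟨ refl⟩∘⟨ ⊗r-resp-≈ (cf f') ⟩∘⟨refl ⟩
    T₁ α⇐ ∘ (P ⊗r ((X ⊗r f') ⊙ (f ⊗l X'))) ∘ α⇒
      ≈⟨ refl⟩∘⟨ ⊗r-⊙ ⟩∘⟨refl ⟩
    T₁ α⇐ ∘ ((P ⊗r (X ⊗r f')) ⊙ (P ⊗r (f ⊗l X'))) ∘ α⇒
      ≈⟨ ⊙-conjugate α-isoʳ ⟨
    (T₁ α⇐ ∘ (P ⊗r (X ⊗r f')) ∘ α⇒) ⊙ (T₁ α⇐ ∘ (P ⊗r (f ⊗l X')) ∘ α⇒)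
      ≈⟨ ⊙-resp-≈ ⊗r-⊗₀ ⊗r-⊗l ⟨
    ((P ⊗₀ X) ⊗r f') ⊙ ((P ⊗r f) ⊗l X')
      ∎

module _ {o ℓ e} {C : Category o ℓ e} {M : SymmetricMonoidal C} (T : StrongMonad M) where
  open Category C
  open SymmetricMonoidal M hiding (unit)
  open StrongMonad T
  open KleisliConstructions T

  record Submonad : Set (o ⊔ ℓ ⊔ e) where
    field
      W          : Obj → Obj
      ι          : ∀ {X} → W X ⇒ T₀ X
      ι-cancel   : ∀ {A X} {a b : A ⇒ W X} → ι ∘ a ≈ ι ∘ b → a ≈ b
      map        : ∀ {X Y} → X ⇒ Y → W X ⇒ W Y
      ι-map      : ∀ {X Y} {f : X ⇒ Y} → ι ∘ map f ≈ T₁ f ∘ ι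
      unit       : ∀ {X} → X ⇒ W X
      ι-unit     : ∀ {X} → ι ∘ unit {X} ≈ η
      join       : ∀ {X} → W (W X) ⇒ W X
      ι-join     : ∀ {X} → ι ∘ join {X} ≈ ι ⊙ ι
      strength   : ∀ {A X} → A ⊗₀ W X ⇒ W (A ⊗₀ X)
      ι-strength : ∀ {A X} → ι ∘ strength {A} {X} ≈ A ⊗r ι

    open HomReasoning C
    open MonoidalLemmas M
    open Centrality T

    ι-map-∘ : ∀ {A X Y} {f : X ⇒ Y} {h : A ⇒ W X} → ι ∘ map f ∘ h ≈ T₁ f ∘ ι ∘ h
    ι-map-∘ = ≈-trans (pullˡ ι-map) assoc

    ι-⊙ : ∀ {A B K} {g : B ⇒ W K} {h : A ⇒ W B} → ι ∘ join ∘ map g ∘ h ≈ (ι ∘ g) ⊙ (ι ∘ h)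
    ι-⊙ {g = g} {h} = begin
      ι ∘ join ∘ map g ∘ h        ≈⟨ pullˡ ι-join ⟩
      (μ ∘ T₁ ι ∘ ι) ∘ map g ∘ h  ≈⟨ assoc²' ⟩
      μ ∘ T₁ ι ∘ ι ∘ map g ∘ h    ≈⟨ refl⟩∘⟨ refl⟩∘⟨ ι-map-∘ ⟩
      μ ∘ T₁ ι ∘ T₁ g ∘ ι ∘ h     ≈⟨ refl⟩∘⟨ pullˡ (≈-sym T-homomorphism) ⟩
      μ ∘ T₁ (ι ∘ g) ∘ ι ∘ h      ∎

    ι-join-map : ∀ {B K} {g : B ⇒ W K} → ι ∘ join ∘ map g ≈ (ι ∘ g) ⊙ ι
    ι-join-map = ≈-trans (refl⟩∘⟨ refl⟩∘⟨ ≈-sym identityʳ)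
                         (≈-trans ι-⊙ (⊙-resp-≈ ≈-refl identityʳ))

    ι-strength-∘ : ∀ {A A' X Y} {f : A ⇒ A'} {h : Y ⇒ W X} →
                   ι ∘ strength ∘ (f ⊗₁ h) ≈ τ ∘ (f ⊗₁ (ι ∘ h))
    ι-strength-∘ {f = f} {h} = begin
      ι ∘ strength ∘ (f ⊗₁ h)      ≈⟨ pullˡ ι-strength ⟩
      (τ ∘ (id ⊗₁ ι)) ∘ (f ⊗₁ h)   ≈⟨ pushˡ ≈-refl ⟩
      τ ∘ (id ⊗₁ ι) ∘ (f ⊗₁ h)     ≈⟨ refl⟩∘⟨ ⊗-homomorphism ⟨
      τ ∘ ((id ∘ f) ⊗₁ (ι ∘ h))    ≈⟨ refl⟩∘⟨ ⊗-resp-≈ identityˡ ≈-refl ⟩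
      τ ∘ (f ⊗₁ (ι ∘ h))           ∎

    map-identity : ∀ {X} → map (id {X}) ≈ id
    map-identity = ι-cancel (begin
      ι ∘ map id   ≈⟨ ι-map ⟩
      T₁ id ∘ ι    ≈⟨ T-identity ⟩∘⟨refl ⟩
      id ∘ ι       ≈⟨ identityˡ ⟩
      ι            ≈⟨ identityʳ ⟨
      ι ∘ id       ∎)

    map-∘ : ∀ {X Y Z} {f : X ⇒ Y} {g : Y ⇒ Z} → map (g ∘ f) ≈ map g ∘ map f
    map-∘ {f = f} {g} = ι-cancel (begin
      ι ∘ map (g ∘ f)    ≈⟨ ι-map ⟩
      T₁ (g ∘ f) ∘ ι     ≈⟨ pushˡ T-homomorphism ⟩
      T₁ g ∘ T₁ f ∘ ι    ≈⟨ refl⟩∘⟨ ι-map ⟨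
      T₁ g ∘ ι ∘ map f   ≈⟨ ι-map-∘ ⟨
      ι ∘ map g ∘ map f  ∎)

    map-resp-≈ : ∀ {X Y} {f g : X ⇒ Y} → f ≈ g → map f ≈ map g
    map-resp-≈ f≈g = ι-cancel (≈-trans ι-map (≈-trans (T-resp-≈ f≈g ⟩∘⟨refl) (≈-sym ι-map)))

    unit-natural : ∀ {X Y} {f : X ⇒ Y} → map f ∘ unit ≈ unit ∘ f
    unit-natural {f = f} = ι-cancel (begin
      ι ∘ map f ∘ unit   ≈⟨ ι-map-∘ ⟩
      T₁ f ∘ ι ∘ unit    ≈⟨ refl⟩∘⟨ ι-unit ⟩
      T₁ f ∘ η           ≈⟨ η-natural ⟩
      η ∘ f              ≈⟨ pullˡ ι-unit ⟨
      ι ∘ unit ∘ f       ∎)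

    join-natural : ∀ {X Y} {f : X ⇒ Y} → map f ∘ join ≈ join ∘ map (map f)
    join-natural {f = f} = ι-cancel (begin
      ι ∘ map f ∘ join         ≈⟨ ι-map-∘ ⟩
      T₁ f ∘ ι ∘ join          ≈⟨ refl⟩∘⟨ ι-join ⟩
      T₁ f ∘ (ι ⊙ ι)           ≈⟨ pure-⊙ ⟨
      (η ∘ f) ⊙ (ι ⊙ ι)        ≈⟨ ⊙-assoc ⟨
      ((η ∘ f) ⊙ ι) ⊙ ι        ≈⟨ ⊙-resp-≈ (≈-trans pure-⊙ (≈-sym ι-map)) ≈-refl ⟩
      (ι ∘ map f) ⊙ ι          ≈⟨ ι-join-map ⟨
      ι ∘ join ∘ map (map f)   ∎)

    join-map-unit : ∀ {X} → join ∘ map (unit {X}) ≈ id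
    join-map-unit = ι-cancel (begin
      ι ∘ join ∘ map unit   ≈⟨ ι-join-map ⟩
      (ι ∘ unit) ⊙ ι        ≈⟨ ⊙-resp-≈ ι-unit ≈-refl ⟩
      η ⊙ ι                 ≈⟨ ⊙-identityˡ ⟩
      ι                     ≈⟨ identityʳ ⟨
      ι ∘ id                ∎)

    join-unit : ∀ {X} → join ∘ unit {W X} ≈ id
    join-unit = ι-cancel (begin
      ι ∘ join ∘ unit       ≈⟨ pullˡ ι-join ⟩
      (ι ⊙ ι) ∘ unit        ≈⟨ assoc²' ⟩
      ι ⊙ (ι ∘ unit)        ≈⟨ ⊙-resp-≈ ≈-refl ι-unit ⟩
      ι ⊙ η                 ≈⟨ ⊙-identityʳ ⟩
      ι                     ≈⟨ identityʳ ⟨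
      ι ∘ id                ∎)

    join-assoc : ∀ {X} → join ∘ map (join {X}) ≈ join ∘ join
    join-assoc = ι-cancel (begin
      ι ∘ join ∘ map join   ≈⟨ ι-join-map ⟩
      (ι ∘ join) ⊙ ι        ≈⟨ ⊙-resp-≈ ι-join ≈-refl ⟩
      (ι ⊙ ι) ⊙ ι           ≈⟨ ⊙-assoc ⟩
      ι ⊙ (ι ⊙ ι)           ≈⟨ ⊙-resp-≈ ≈-refl ι-join ⟨
      ι ⊙ (ι ∘ join)        ≈⟨ assoc²' ⟨
      (ι ⊙ ι) ∘ join        ≈⟨ pullˡ ι-join ⟨
      ι ∘ join ∘ join       ∎)

    strength-natural : ∀ {A A' X Y} {f : A ⇒ A'} {g : X ⇒ Y} →
                       strength ∘ (f ⊗₁ map g) ≈ map (f ⊗₁ g) ∘ strength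
    strength-natural {f = f} {g} = ι-cancel (begin
      ι ∘ strength ∘ (f ⊗₁ map g)     ≈⟨ ι-strength-∘ ⟩
      τ ∘ (f ⊗₁ (ι ∘ map g))          ≈⟨ refl⟩∘⟨ ⊗-resp-≈ ≈-refl ι-map ⟩
      τ ∘ (f ⊗₁ (T₁ g ∘ ι))           ≈⟨ refl⟩∘⟨ ≈-trans (⊗-resp-≈ (≈-sym identityʳ) ≈-refl) ⊗-homomorphism ⟩
      τ ∘ (f ⊗₁ T₁ g) ∘ (id ⊗₁ ι)     ≈⟨ pullˡ τ-natural ⟩
      (T₁ (f ⊗₁ g) ∘ τ) ∘ (id ⊗₁ ι)   ≈⟨ assoc ⟩
      T₁ (f ⊗₁ g) ∘ τ ∘ (id ⊗₁ ι)     ≈⟨ refl⟩∘⟨ ι-strength ⟨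
      T₁ (f ⊗₁ g) ∘ ι ∘ strength      ≈⟨ ι-map-∘ ⟨
      ι ∘ map (f ⊗₁ g) ∘ strength     ∎)

    strength-λ : ∀ {X} → map λ⇒ ∘ strength {SymmetricMonoidal.unit M} {X} ≈ λ⇒
    strength-λ = ι-cancel (begin
      ι ∘ map λ⇒ ∘ strength     ≈⟨ ι-map-∘ ⟩
      T₁ λ⇒ ∘ ι ∘ strength      ≈⟨ refl⟩∘⟨ ι-strength ⟩
      T₁ λ⇒ ∘ τ ∘ (id ⊗₁ ι)     ≈⟨ pullˡ τ-λ ⟩
      λ⇒ ∘ (id ⊗₁ ι)            ≈⟨ λ-natural ⟩
      ι ∘ λ⇒                    ∎)

    strength-α : ∀ {X Y Z} →
                 map α⇒ ∘ strength {X ⊗₀ Y} {Z} ≈ strength ∘ (id ⊗₁ strength) ∘ α⇒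
    strength-α = ι-cancel (begin
      ι ∘ map α⇒ ∘ strength                     ≈⟨ ι-map-∘ ⟩
      T₁ α⇒ ∘ ι ∘ strength                      ≈⟨ refl⟩∘⟨ ι-strength ⟩
      T₁ α⇒ ∘ τ ∘ (id ⊗₁ ι)                     ≈⟨ pullˡ τ-α ⟩
      (τ ∘ (id ⊗₁ τ) ∘ α⇒) ∘ (id ⊗₁ ι)          ≈⟨ assoc²' ⟩
      τ ∘ (id ⊗₁ τ) ∘ α⇒ ∘ (id ⊗₁ ι)            ≈⟨ refl⟩∘⟨ refl⟩∘⟨ refl⟩∘⟨ ⊗-resp-≈ ⊗-identity ≈-refl ⟨
      τ ∘ (id ⊗₁ τ) ∘ α⇒ ∘ ((id ⊗₁ id) ⊗₁ ι)    ≈⟨ refl⟩∘⟨ refl⟩∘⟨ α-natural ⟩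
      τ ∘ (id ⊗₁ τ) ∘ (id ⊗₁ (id ⊗₁ ι)) ∘ α⇒    ≈⟨ refl⟩∘⟨ pullˡ (≈-sym split₂) ⟩
      τ ∘ (id ⊗₁ (τ ∘ (id ⊗₁ ι))) ∘ α⇒          ≈⟨ refl⟩∘⟨ ⊗-resp-≈ ≈-refl ι-strength ⟩∘⟨refl ⟨
      τ ∘ (id ⊗₁ (ι ∘ strength)) ∘ α⇒           ≈⟨ pushˡ ι-strength-∘ ⟨
      (ι ∘ strength ∘ (id ⊗₁ strength)) ∘ α⇒    ≈⟨ assoc²' ⟩
      ι ∘ strength ∘ (id ⊗₁ strength) ∘ α⇒      ∎)

    strength-unit : ∀ {A X} → strength ∘ (id {A} ⊗₁ unit {X}) ≈ unit
    strength-unit = ι-cancel (begin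
      ι ∘ strength ∘ (id ⊗₁ unit)   ≈⟨ ι-strength-∘ ⟩
      τ ∘ (id ⊗₁ (ι ∘ unit))        ≈⟨ ⊗r-resp-≈ ι-unit ⟩
      τ ∘ (id ⊗₁ η)                 ≈⟨ τ-η ⟩
      η                             ≈⟨ ι-unit ⟨
      ι ∘ unit                      ∎)

    strength-join : ∀ {A X} → strength ∘ (id {A} ⊗₁ join {X}) ≈ join ∘ map strength ∘ strength
    strength-join {A} = ι-cancel (begin
      ι ∘ strength ∘ (id ⊗₁ join)         ≈⟨ ι-strength-∘ ⟩
      A ⊗r (ι ∘ join)                     ≈⟨ ⊗r-resp-≈ ι-join ⟩
      A ⊗r (ι ⊙ ι)                        ≈⟨ ⊗r-⊙ ⟩
      (A ⊗r ι) ⊙ (A ⊗r ι)                 ≈⟨ ⊙-resp-≈ ι-strength ι-strength ⟨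
      (ι ∘ strength) ⊙ (ι ∘ strength)     ≈⟨ ι-⊙ ⟨
      ι ∘ join ∘ map strength ∘ strength  ∎)

    monad : StrongMonad M
    monad = record
      { T₀             = W
      ; T₁             = map
      ; T-identity     = map-identity
      ; T-homomorphism = map-∘
      ; T-resp-≈       = map-resp-≈
      ; η              = unit
      ; μ              = join
      ; η-natural      = unit-natural
      ; μ-natural      = join-natural
      ; identityˡ-μ    = join-map-unit
      ; identityʳ-μ    = join-unit
      ; assoc-μ        = join-assoc
      ; τ              = strength
      ; τ-natural      = strength-natural
      ; τ-λ            = strength-λ
      ; τ-α            = strength-α
      ; τ-η            = strength-unit
      ; τ-μ            = strength-join
      }

    inclusion : StrongMonadMorphism monad T
    inclusion = record
      { ι = ι ; ι-natural = ι-map ; ι-η = ι-unit ; ι-μ = ι-join ; ι-τ = ι-strength }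

    inclusion-mono : IsMonoStrong inclusion
    inclusion-mono _ _ _ ιa≈ιb = ι-cancel ιa≈ιb

    ι-costrength : ∀ {X Y} → ι ∘ StrongMonad.τ' monad {X} {Y} ≈ ι ⊗l Y
    ι-costrength = begin
      ι ∘ map γ ∘ strength ∘ γ     ≈⟨ ι-map-∘ ⟩
      T₁ γ ∘ ι ∘ strength ∘ γ      ≈⟨ refl⟩∘⟨ pullˡ ι-strength ⟩
      T₁ γ ∘ (τ ∘ (id ⊗₁ ι)) ∘ γ   ≈⟨ refl⟩∘⟨ pushˡ ≈-refl ⟩
      T₁ γ ∘ τ ∘ (id ⊗₁ ι) ∘ γ     ≈⟨ refl⟩∘⟨ refl⟩∘⟨ γ-natural ⟨
      T₁ γ ∘ τ ∘ γ ∘ (ι ⊗₁ id)     ≈⟨ assoc²' ⟨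
      ι ⊗l _                       ∎

    central⇒commutative : (∀ {X} → IsCentral (ι {X})) → StrongMonad.IsCommutative monad
    central⇒commutative ι-central {X} {Y} = ι-cancel (begin
      ι ∘ join ∘ map τ'Z ∘ strength     ≈⟨ ι-⊙ ⟩
      (ι ∘ τ'Z) ⊙ (ι ∘ strength)        ≈⟨ ⊙-resp-≈ ι-costrength ι-strength ⟩
      (ι ⊗l Y) ⊙ (W X ⊗r ι)             ≈⟨ ι-central ι ⟩
      (X ⊗r ι) ⊙ (ι ⊗l W Y)             ≈⟨ ⊙-resp-≈ ι-strength ι-costrength ⟨
      (ι ∘ strength) ⊙ (ι ∘ τ'Z)        ≈⟨ ι-⊙ ⟨
      ι ∘ join ∘ map strength ∘ τ'Z     ∎)
      where
      τ'Z : ∀ {A B} → W A ⊗₀ B ⇒ W (A ⊗₀ B)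
      τ'Z = StrongMonad.τ' monad

module TerminalCentralCone {o ℓ e} {C : Category o ℓ e} {M : SymmetricMonoidal C}
                           (T : StrongMonad M) {X} (terminal : HasTerminalCentralCone T X) where
  open Category C
  open StrongMonad T
  open Centrality T

  open CentralCone (proj₁ terminal) public using (W; ι)

  ι-central : IsCentral ι
  ι-central = cone-isCentral (proj₁ terminal)

  factor : ∀ {A} (f : A ⇒ T₀ X) → IsCentral f → A ⇒ W
  factor f cf = proj₁ (proj₁ (proj₂ terminal (centralCone f cf)))

  factor-commutes : ∀ {A} {f : A ⇒ T₀ X} (cf : IsCentral f) → ι ∘ factor f cf ≈ f
  factor-commutes cf = proj₂ (proj₁ (proj₂ terminal (centralCone _ cf)))

  factor-unique : ∀ {A} {f : A ⇒ T₀ X} (cf : IsCentral f) {h : A ⇒ W} →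
                  ι ∘ h ≈ f → h ≈ factor f cf
  factor-unique cf {h} ιh≈f = proj₂ (proj₂ terminal (centralCone _ cf)) (h , ιh≈f)

  ι-cancel : ∀ {A} {a b : A ⇒ W} → ι ∘ a ≈ ι ∘ b → a ≈ b
  ι-cancel {a = a} ιa≈ιb =
    ≈-trans (factor-unique ιa-central ≈-refl) (≈-sym (factor-unique ιa-central (≈-sym ιa≈ιb)))
    where
    ιa-central : IsCentral (ι ∘ a)
    ιa-central = central-∘ʳ a ι-central

module _ {o ℓ e} {C : Category o ℓ e} {M : SymmetricMonoidal C} (T : StrongMonad M) where
  open Category C
  open StrongMonad T
  open KleisliConstructions T
  open HomReasoning C
  open Centrality T

  record CentralSubmonad : Set (o ⊔ ℓ ⊔ e) where
    field
      submonad : Submonad T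
    open Submonad submonad public
    field
      ι-central       : ∀ {X} → IsCentral (ι {X})
      factor          : ∀ {A X} {f : A ⇒ T₀ X} → IsCentral f → A ⇒ W X
      factor-commutes : ∀ {A X} {f : A ⇒ T₀ X} (cf : IsCentral f) → ι ∘ factor cf ≈ f

  condition1⇒centralSubmonad : Condition1 T → CentralSubmonad
  condition1⇒centralSubmonad cones = record
    { submonad = record
      { W          = λ X → Cone.W {X}
      ; ι          = Cone.ι
      ; ι-cancel   = Cone.ι-cancel
      ; map        = λ f → Cone.factor _ (T₁-∘-central f Cone.ι-central)
      ; ι-map      = Cone.factor-commutes (T₁-∘-central _ Cone.ι-central)
      ; unit       = Cone.factor η η-central
      ; ι-unit     = Cone.factor-commutes η-central
      ; join       = Cone.factor _ ι⊙ι-central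
      ; ι-join     = Cone.factor-commutes ι⊙ι-central
      ; strength   = Cone.factor _ (⊗r-central Cone.ι-central)
      ; ι-strength = Cone.factor-commutes (⊗r-central Cone.ι-central)
      }
    ; ι-central       = Cone.ι-central
    ; factor          = Cone.factor _
    ; factor-commutes = Cone.factor-commutes
    }
    where
    module Cone {X} = TerminalCentralCone T (cones X)

    ι⊙ι-central : ∀ {X} → IsCentral (Cone.ι {X} ⊙ Cone.ι)
    ι⊙ι-central = ⊙-central Cone.ι-central Cone.ι-central

  centralSubmonad⇒condition2 : CentralSubmonad → Condition2 T
  centralSubmonad⇒condition2 Z =
    monad , central⇒commutative ι-central , inclusion , inclusion-mono , lands , iso
    where
    open CentralSubmonad Z

    lands : ∀ {A B} (f : A ⇒ W B) → IsCentral (ι ∘ f)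
    lands f = central-∘ʳ f ι-central

    factorCentral : ∀ {A B} → Σ (A ⇒ T₀ B) IsCentral → A ⇒ W B
    factorCentral (f , cf) = factor cf

    ι-factorCentral : ∀ {A B} (f : Σ (A ⇒ T₀ B) IsCentral) → ι ∘ factorCentral f ≈ proj₁ f
    ι-factorCentral (f , cf) = factor-commutes cf

    fromCentre : Functor Centre (KleisliConstructions.Kleisli monad)
    fromCentre = record
      { F₀ = λ X → X
      ; F₁ = factorCentral
      ; identity = ι-cancel (≈-trans (factor-commutes η-central) (≈-sym ι-unit))
      ; homomorphism = λ {_} {_} {_} {f} {g} → ι-cancel (begin
          ι ∘ factorCentral (g Centre.∘ f)                   ≈⟨ ι-factorCentral (g Centre.∘ f) ⟩
          proj₁ g ⊙ proj₁ f                                  ≈⟨ ⊙-resp-≈ (ι-factorCentral g) (ι-factorCentral f) ⟨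
          (ι ∘ factorCentral g) ⊙ (ι ∘ factorCentral f)      ≈⟨ ι-⊙ ⟨
          ι ∘ join ∘ map (factorCentral g) ∘ factorCentral f ∎)
      ; F-resp-≈ = λ {_} {_} {f} {g} f≈g →
          ι-cancel (≈-trans (ι-factorCentral f) (≈-trans f≈g (≈-sym (ι-factorCentral g))))
      }
      where module Centre = Category Centre

    iso : IsIsomorphism (corestrict (CanonicalEmbedding inclusion) CentralPred lands)
    iso = record
      { inverse = fromCentre
      ; GF₀ = λ _ → refl
      ; FG₀ = λ _ → refl
      ; GF₁ = λ f → ι-cancel (factor-commutes (lands f))
      ; FG₁ = ι-factorCentral
      }

  condition1⇒condition2 : Condition1 T → Condition2 T
  condition1⇒condition2 cones = centralSubmonad⇒condition2 (condition1⇒centralSubmonad cones)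

module _ {o ℓ e} {C : Category o ℓ e} {M : SymmetricMonoidal C} (T : StrongMonad M) where
  open Category C
  open StrongMonad T
  open KleisliConstructions T
  open Centrality T

  condition2⇒condition1 : Condition2 T → Condition1 T
  condition2⇒condition1 (Z , _ , i , _ , lands , iso) X = cone , terminal
    where
    module Z = StrongMonad Z
    open StrongMonadMorphism i
    F : Functor (KleisliConstructions.Kleisli Z) Centre
    F = corestrict (CanonicalEmbedding i) CentralPred lands
    module F = Functor F
    open IsIsomorphism iso
    module G = Functor inverse
    module Centre = Category Centre

    -- G inverts F only up to the object equalities GF₀ and FG₀, along which G's action on
    -- morphisms has to be transported.
    transport : ∀ {A B A' B'} → A ≡ A' → B ≡ B' → A ⇒ Z.T₀ B → A' ⇒ Z.T₀ B'
    transport = subst₂ (λ A B → A ⇒ Z.T₀ B)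

    ι∘transport : ∀ {A B A' B'} (p : A ≡ A') (q : B ≡ B') (h : A ⇒ Z.T₀ B) →
                  ι ∘ transport p q h ≡ proj₁ (subst₂ Centre._⇒_ p q (F.F₁ h))
    ι∘transport refl refl h = refl

    transport-resp-≈ : ∀ {A B A' B'} (p p' : A ≡ A') (q q' : B ≡ B') {h h' : A ⇒ Z.T₀ B} →
                       h ≈ h' → transport p q h ≈ transport p' q' h'
    transport-resp-≈ refl refl refl refl h≈h' = h≈h'

    cone : CentralCone T X
    cone = centralCone ι (central-resp-≈ identityʳ (lands id))

    terminal : IsTerminalCentralCone T cone
    terminal c' = (φ , ι∘φ) , unique
      where
      open CentralCone c' renaming (W to W'; ι to ι')
      g : W' Centre.⇒ X
      g = ι' , cone-isCentral c'

      φ : W' ⇒ Z.T₀ X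
      φ = transport (FG₀ W') (FG₀ X) (G.F₁ g)

      ι∘φ : ι ∘ φ ≈ ι'
      ι∘φ = ≈-trans (IsEquivalence.reflexive equiv (ι∘transport (FG₀ W') (FG₀ X) (G.F₁ g))) (FG₁ g)

      unique : (ψ : ConeMorphism T c' cone) → proj₁ ψ ≈ φ
      unique (ψ , ιψ≈ι') = ≈-trans (≈-sym (GF₁ ψ))
        (transport-resp-≈ (GF₀ W') (FG₀ W') (GF₀ X) (FG₀ X) (G.F-resp-≈ ιψ≈ι'))

  terminalCentralCone⇒universalArrow : ∀ {X} → HasTerminalCentralCone T X → UniversalArrow Ĵ X
  terminalCentralCone⇒universalArrow terminal = record
    { obj = W
    ; counit = ι , ι-central
    ; factor = λ g → factor (proj₁ g) (proj₂ g)
    ; factor-commutes = λ g → ≈-trans ⊙-pure (factor-commutes (proj₂ g))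
    ; factor-unique = λ {_} {g} p → factor-unique (proj₂ g) (≈-trans (≈-sym ⊙-pure) p)
    }
    where open TerminalCentralCone T terminal

  universalArrow⇒terminalCentralCone : ∀ {X} → UniversalArrow Ĵ X → HasTerminalCentralCone T X
  universalArrow⇒terminalCentralCone {X} u = cone , terminal
    where
    open UniversalArrow u
    cone : CentralCone T X
    cone = centralCone (proj₁ counit) (proj₂ counit)

    terminal : IsTerminalCentralCone T cone
    terminal c' =
      (factor g , ≈-trans (≈-sym ⊙-pure) (factor-commutes g)) ,
      λ ψ → factor-unique (≈-trans ⊙-pure (proj₂ ψ))
      where
      g : Σ (CentralCone.W c' ⇒ T₀ X) IsCentral
      g = CentralCone.ι c' , cone-isCentral c'

  condition1⇒condition3 : Condition1 T → Condition3 T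
  condition1⇒condition3 cones =
    universalArrows⇒isLeftAdjoint Ĵ (λ X → terminalCentralCone⇒universalArrow (cones X))

  condition3⇒condition1 : Condition3 T → Condition1 T
  condition3⇒condition1 adjoint X =
    universalArrow⇒terminalCentralCone (isLeftAdjoint⇒universalArrow Ĵ adjoint X)

theorem2p11 : ∀ {o ℓ e} (C : Category o ℓ e) (M : SymmetricMonoidal C)
                (T : StrongMonad M) →
              (Condition1 T ⇔ Condition2 T) × (Condition2 T ⇔ Condition3 T)
theorem2p11 C M T =
  mk⇔ (condition1⇒condition2 T) (condition2⇒condition1 T) ,
  mk⇔ (λ c₂ → condition1⇒condition3 T (condition2⇒condition1 T c₂))
      (λ c₃ → condition1⇒condition2 T (condition3⇒condition1 T c₃))
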